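{- Let $G=(V,E)$ be a simple graph on $V=\{1,\dots,n\}$ that has a perfect matching, let $T'$ be an evaluation of its Tutte matrix with $\operatorname{rank} T'=n$, and let $W:E\to\mathbb{N}$ be a weight assignment. Let $A=T'\circ W$, and let $w_0$ be the least integer such that $z^{w_0}$ has nonzero coefficient in $\operatorname{Pf}(A)$. Then at least one of the following holds: (1) there exists $e\in E$ such that, writing $\operatorname{Pf}(A_e)=P_0(z)+yP_1(z)$, both $P_0$ and $P_1$ are nonzero and $W(e)=w_{\bar e}-w_e$, where $w_{\bar e}$ is the least degree of a monomial with nonzero coefficient in $P_0$ and $w_e$ is the least degree of a monomial with nonzero coefficient in $P_1$; (2) $M=\{e\in E: c^{\bar e}_{w_0}=0\}$ is a perfect matching of $G$; moreover $M$ is exactly the set of edges $e\in E$ such that $P_0$ (where $\operatorname{Pf}(A_e)=P_0+yP_1$) does not contain the monomial $z^{w_0}$ with nonzero coefficient.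
   Context: The Tutte matrix $T$ of $G$ has entries $T_{uv}=x_e$ if $u<v$, $e=\{u,v\}\in E$; $T_{uv}=-x_e$ if $u>v$, $e=\{u,v\}\in E$; $0$ otherwise; an evaluation substitutes rational values for the variables. For a skew-symmetric $2k\times 2k$ matrix $B$, $\operatorname{Pf}(B)=\frac{1}{2^k k!}\sum_{\sigma\in S_{2k}}\operatorname{sgn}(\sigma)\prod_{i=1}^k B_{\sigma(2i-1),\sigma(2i)}$. With $z,y$ indeterminates: $T'\circ W$ is the skew-symmetric matrix with $(T'\circ W)_{uv}=T'_{uv}z^{W(\{u,v\})}$ if $\{u,v\}\in E$ and $0$ otherwise. For an edge $e=\{i,j\}$, $A_e$ is obtained from $A$ by replacing the entries $A_{ij},A_{ji}$ by $T'_{ij}y$ and $T'_{ji}y$ respectively (i.e. multiplying by $y$ and setting the weight of $e$ to $0$); then $\operatorname{Pf}(A_e)=P_0(z)+yP_1(z)$ for univariate polynomials $P_0,P_1$ in $z$. Let $\mathcal{M}$ be the set of perfect matchings of $G$. Let $T'_X$ be $T'$ with entries $T'_{ij},T'_{ji}$ multiplied by a new variable $x_{ij}$ for each $\{i,j\}\in E$; for $M\in\mathcal{M}$, $c_M$ is the coefficient of $\prod_{e\in M}x_e$ in $\operatorname{Pf}(T'_X)$. For $w\in\mathbb{N}$ and $e\in E$: $c_w=\sum_{M\in\mathcal{M}:W(M)=w}c_M$, $c_w^{\bar e}=\sum_{M\in\mathcal{M}:W(M)=w,\,e\notin M}c_M$, where $W(M)=\sum_{f\in M}W(f)$. -}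

module Defs where

open import Data.Bool.Base using (Bool; true; false; if_then_else_; _∧_; _∨_; not; T)
open import Data.Nat.Base as ℕ using (ℕ; zero; suc; _^_; _!; ⌊_/2⌋; _<ᵇ_; NonZero)
open import Data.Nat.Properties using (m*n≢0; m^n≢0; _!≢0)
open import Data.Fin.Base using (Fin; toℕ)
open import Data.Fin.Properties using () renaming (_≟_ to _≟F_)
open import Data.Integer.Base using (+_)
open import Data.Rational.Base using (ℚ; 0ℚ; 1ℚ; _+_; _*_; -_; _/_)
open import Data.List.Base using (List; []; _∷_; map; concatMap; foldr; filter; length; _++_; allFin)
open import Data.Vec.Base using (Vec; tabulate; lookup; zipWith; replicate) renaming ([] to []ᵛ; _∷_ to _∷ᵛ_)
open import Data.Vec.Properties using () renaming (≡-dec to Vec-≡-dec)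
open import Data.Product.Base using (_×_; _,_; Σ; ∃; proj₁; proj₂)
open import Data.Product.Properties using () renaming (≡-dec to ×-≡-dec)
open import Relation.Nullary using (does; ¬_)
open import Relation.Binary.Definitions using (DecidableEquality)
open import Relation.Binary.PropositionalEquality using (_≡_)
import Data.Nat.Properties as ℕP

-- Simple graphs on the vertex set Fin n  (vertex i ↔ i+1 ∈ {1..n})

record SimpleGraph (n : ℕ) : Set where
  field
    Adj    : Fin n → Fin n → Bool
    sym    : ∀ u v → Adj u v ≡ Adj v u
    irrefl : ∀ u → Adj u u ≡ false
open SimpleGraph public

_<F_ : ∀ {n} → Fin n → Fin n → Bool
u <F v = toℕ u <ᵇ toℕ v

_==F_ : ∀ {n} → Fin n → Fin n → Bool
u ==F v = does (u ≟F v)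

lo hi : ∀ {n} → Fin n → Fin n → Fin n
lo u v = if u <F v then u else v
hi u v = if u <F v then v else u

sumℚ : List ℚ → ℚ
sumℚ = foldr _+_ 0ℚ

signℚ : ℕ → ℚ
signℚ zero    = 1ℚ
signℚ (suc k) = - signℚ k

-- Evaluation of the Tutte matrix.
-- An evaluation assigns a rational x(i,j) to each edge {i,j}, read at
-- the ordered pair with i < j.  T'_{uv} = x_e (u<v), -x_e (u>v), 0 otherwise.

tutteEval : ∀ {n} → SimpleGraph n → (Fin n → Fin n → ℚ) → Fin n → Fin n → ℚ
tutteEval G x u v =
  if Adj G u v then (if u <F v then x u v else - x v u) else 0ℚ

-- rank T' = n for an n×n rational matrix: the columns are linearly
-- independent (trivial kernel).
FullRank : ∀ {n} → (Fin n → Fin n → ℚ) → Set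
FullRank {n} M =
  (c : Fin n → ℚ) →
  (∀ u → sumℚ (map (λ v → M u v * c v) (allFin n)) ≡ 0ℚ) →
  ∀ v → c v ≡ 0ℚ

-- Polynomials with rational coefficients, as formal sums of terms
-- (monomial , coefficient) over a commutative monoid of monomials.

Poly : Set → Set
Poly M = List (M × ℚ)

coeff : ∀ {M : Set} → DecidableEquality M → Poly M → M → ℚ
coeff _≟_ p m = sumℚ (map proj₂ (filter (λ t → proj₁ t ≟ m) p))

insertAll : ∀ {A : Set} → A → List A → List (List A)
insertAll x []       = (x ∷ []) ∷ []
insertAll x (y ∷ ys) = (x ∷ y ∷ ys) ∷ map (y ∷_) (insertAll x ys)

perms : ∀ {A : Set} → List A → List (List A)
perms []       = [] ∷ []
perms (x ∷ xs) = concatMap (insertAll x) (perms xs)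

inversions : ∀ {n} → List (Fin n) → ℕ
inversions []       = 0
inversions (x ∷ xs) = length (filter (λ y → ℕP._<?_ (toℕ y) (toℕ x)) xs) ℕ.+ inversions xs

pairsOf : ∀ {A : Set} → List A → List (A × A)
pairsOf (a ∷ b ∷ r) = (a , b) ∷ pairsOf r
pairsOf _           = []

pfNorm : ℕ → ℚ
pfNorm k = (+ 1 / (2 ^ k ℕ.* k !)) {{nz}}
  where
  nz : NonZero (2 ^ k ℕ.* k !)
  nz = m*n≢0 (2 ^ k) (k !) {{m^n≢0 2 k}} {{k !≢0}}

module PolyOps {M : Set} (ε : M) (_·_ : M → M → M) where

  _⊗_ : Poly M → Poly M → Poly M
  p ⊗ q = concatMap (λ s → map (λ t → (proj₁ s · proj₁ t , proj₂ s * proj₂ t)) q) p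

  scaleP : ℚ → Poly M → Poly M
  scaleP a = map (λ t → (proj₁ t , a * proj₂ t))

  sumP : List (Poly M) → Poly M
  sumP = foldr _++_ []

  prodP : List (Poly M) → Poly M
  prodP = foldr _⊗_ ((ε , 1ℚ) ∷ [])

  Pf : (n : ℕ) → (Fin n → Fin n → Poly M) → Poly M
  Pf n B = scaleP (pfNorm ⌊ n /2⌋)
    (sumP (map (λ σ → scaleP (signℚ (inversions σ))
                        (prodP (map (λ p → B (proj₁ p) (proj₂ p)) (pairsOf σ))))
               (perms (allFin n))))

-- Bivariate polynomials in z, y: monomial (a , b) = z^a y^b

Mon₂ : Set
Mon₂ = ℕ × ℕ

module P2 = PolyOps {Mon₂} (0 , 0) (λ s t → (proj₁ s ℕ.+ proj₁ t , proj₂ s ℕ.+ proj₂ t))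

coeff₂ : Poly Mon₂ → Mon₂ → ℚ
coeff₂ = coeff (×-≡-dec ℕP._≟_ ℕP._≟_)

-- weight of the edge {u,v}; W is read at the ordered pair (lo,hi)
wt : ∀ {n} → (Fin n → Fin n → ℕ) → Fin n → Fin n → ℕ
wt W u v = W (lo u v) (hi u v)

weighted : ∀ {n} → SimpleGraph n → (Fin n → Fin n → ℚ) → (Fin n → Fin n → ℕ) →
           Fin n → Fin n → Poly Mon₂
weighted G T' W u v =
  if Adj G u v then ((wt W u v , 0) , T' u v) ∷ [] else []

-- A_e for e = {i,j}: entries (i,j),(j,i) become T'_{ij} y, T'_{ji} y
weightedAt : ∀ {n} → SimpleGraph n → (Fin n → Fin n → ℚ) → (Fin n → Fin n → ℕ) →
             Fin n → Fin n → Fin n → Fin n → Poly Mon₂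
weightedAt G T' W i j u v =
  if (u ==F i ∧ v ==F j) ∨ (u ==F j ∧ v ==F i)
  then ((0 , 1) , T' u v) ∷ []
  else weighted G T' W u v

-- P₀, P₁ with Pf(A_e) = P₀(z) + y P₁(z), as coefficient functions in z
P₀ P₁ : ∀ {n} → SimpleGraph n → (Fin n → Fin n → ℚ) → (Fin n → Fin n → ℕ) →
        Fin n → Fin n → ℕ → ℚ
P₀ {n} G T' W i j a = coeff₂ (P2.Pf n (weightedAt G T' W i j)) (a , 0)
P₁ {n} G T' W i j a = coeff₂ (P2.Pf n (weightedAt G T' W i j)) (a , 1)

NonZeroPoly : (ℕ → ℚ) → Set
NonZeroPoly p = ∃ λ a → ¬ (p a ≡ 0ℚ)

LeastDeg : (ℕ → ℚ) → ℕ → Set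
LeastDeg p w = ¬ (p w ≡ 0ℚ) × (∀ v → v ℕ.< w → p v ≡ 0ℚ)

-- Perfect matchings, represented by their mate function
-- (mate u = the vertex matched with u)

allᵇ : ∀ {A : Set} → (A → Bool) → List A → Bool
allᵇ p = foldr (λ a b → p a ∧ b) true

isPMᵇ : ∀ {n} → SimpleGraph n → Vec (Fin n) n → Bool
isPMᵇ {n} G m = allᵇ (λ u → not (lookup m u ==F u)
                          ∧ (lookup m (lookup m u) ==F u)
                          ∧ Adj G u (lookup m u)) (allFin n)

HasPerfectMatching : ∀ {n} → SimpleGraph n → Set
HasPerfectMatching {n} G = Σ (Vec (Fin n) n) (λ m → T (isPMᵇ G m))

allVecs : (k n : ℕ) → List (Vec (Fin n) k)
allVecs zero    n = []ᵛ ∷ []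
allVecs (suc k) n = concatMap (λ f → map (_∷ᵛ f) (allFin n)) (allVecs k n)

perfectMatchings : ∀ {n} → SimpleGraph n → List (Vec (Fin n) n)
perfectMatchings {n} G = filter (λ m → T? (isPMᵇ G m)) (allVecs n n)
  where
  open import Relation.Nullary.Decidable using (Dec; yes; no)
  open import Data.Unit.Base using (tt)
  T? : (b : Bool) → Dec (T b)
  T? true  = yes tt
  T? false = no (λ ())

inPM : ∀ {n} → Vec (Fin n) n → Fin n → Fin n → Bool
inPM m i j = lookup m i ==F j

weightPM : ∀ {n} → (Fin n → Fin n → ℕ) → Vec (Fin n) n → ℕ
weightPM {n} W m =
  foldr ℕ._+_ 0 (map (λ u → if u <F lookup m u then W u (lookup m u) else 0) (allFin n))

-- Polynomials in the edge variables x_{ij} (i < j):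
-- monomials are exponent matrices, entry (i,j) = exponent of x_{ij}.

MonX : ℕ → Set
MonX n = Vec (Vec ℕ n) n

module PX (n : ℕ) = PolyOps {MonX n} (replicate n (replicate n 0))
                                     (zipWith (zipWith ℕ._+_))

coeffX : ∀ {n} → Poly (MonX n) → MonX n → ℚ
coeffX = coeff (Vec-≡-dec (Vec-≡-dec ℕP._≟_))

xVar : ∀ {n} → Fin n → Fin n → MonX n
xVar i j = tabulate (λ a → tabulate (λ b → if a ==F i ∧ b ==F j then 1 else 0))

tutteX : ∀ {n} → SimpleGraph n → (Fin n → Fin n → ℚ) → Fin n → Fin n → Poly (MonX n)
tutteX G T' u v = if Adj G u v then (xVar (lo u v) (hi u v) , T' u v) ∷ [] else []

pmMonomial : ∀ {n} → Vec (Fin n) n → MonX n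
pmMonomial m = tabulate (λ a → tabulate (λ b → if a <F b ∧ lookup m a ==F b then 1 else 0))

cM : ∀ {n} → SimpleGraph n → (Fin n → Fin n → ℚ) → Vec (Fin n) n → ℚ
cM {n} G T' m = coeffX (PX.Pf n n (tutteX G T')) (pmMonomial m)

cBar : ∀ {n} → SimpleGraph n → (Fin n → Fin n → ℚ) → (Fin n → Fin n → ℕ) →
       Fin n → Fin n → ℕ → ℚ
cBar G T' W i j w =
  sumℚ (map (cM G T')
    (filter (λ m → weightPM W m ℕP.≟ w) 
      (filter (λ m → T?n (inPM m i j)) (perfectMatchings G))))
  where
  open import Relation.Nullary.Decidable using (Dec; yes; no)
  T?n : (b : Bool) → Dec (T (not b))
  T?n true  = no (λ ())
  T?n false = yes _

-- Substituting x_f ↦ z^W(f) in Pf(T′_X) gives Pf(A); substituting x_e ↦ y and x_f ↦ z^W(f) for f ≠ e gives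
-- Pf(A_e). Every monomial of Pf(T′_X) is Π_{f ∈ M} x_f for exactly one perfect matching M, with coefficient c_M.
-- Hence [z^w] Pf(A) = c_w, [z^w] P₀ = c^ē_w and [z^d] P₁ = c^e_{d + W(e)}, where c^e_w sums c_M over the matchings
-- of weight w that contain e; so c_w = c^ē_w + c^e_w, i.e. Pf(A) = P₀ + z^W(e) P₁.
--
-- If c^ē_{w₀} ≠ 0 and c^e_{w₀} ≠ 0 for some edge e, then P₀ and P₁ are nonzero with lowest degrees w_ē ≤ w₀ and
-- w_e + W(e) ≤ w₀, and since Pf(A) = P₀ + z^W(e) P₁ has no monomial below z^w₀ these two degrees must coincide.
-- Otherwise c^e_{w₀} ≠ 0 forces c^ē_{w₀} = 0, so every c^e_{w₀} is 0 or c_{w₀}. A perfect matching meets a vertex u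
-- in exactly one edge, so Σ_v c^{uv}_{w₀} = c_{w₀} ≠ 0; in characteristic 0 exactly one edge uv has c^{uv}_{w₀} ≠ 0,
-- equivalently c^ē_{w₀} = 0 for e = uv, and these edges form the perfect matching of the second alternative.

module Submission where

open import Algebra.Structures using (IsCommutativeMonoid)
open import Data.Bool.Base using (Bool; true; false; if_then_else_; _∧_; _∨_; not; T)
open import Data.Bool.Properties using (∧-zeroʳ; ∧-identityʳ; ∧-conicalˡ; ∧-conicalʳ; T-≡; T-∧; T-not-≡)
import Data.Bool.Properties as BoolP
open import Data.Fin.Base using (Fin; zero; suc; toℕ)
open import Data.Fin.Properties using (toℕ-injective; suc-injective; any?) renaming (_≟_ to _≟F_)
open import Data.Integer.Base using (+_; _-_)
import Data.Integer.Properties as ℤP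
open import Data.List.Base using (List; []; _∷_; map; foldr; filter; _++_; concatMap; allFin; length)
import Data.List.Base as List
open import Data.List.Properties using (map-tabulate; map-++; map-∘; map-cong; length-tabulate; filter-accept; filter-reject)
open import Data.List.Membership.Propositional using (_∈_; _∉_; find)
open import Data.List.Membership.Propositional.Properties
  using (∈-map⁻; ∈-concat⁻′; ∈-concatMap⁻; ∈-allFin; ∈-filter⁺; ∈-filter⁻)
open import Data.List.Relation.Unary.Any using (here; there)
open import Data.List.Relation.Unary.All using (All; []; _∷_)
import Data.List.Relation.Unary.All as All
open import Data.List.Relation.Unary.All.Properties using (All¬⇒¬Any)
open import Data.List.Relation.Unary.AllPairs using ([]; _∷_)
open import Data.List.Relation.Unary.Unique.Propositional using (Unique)
open import Data.List.Relation.Unary.Unique.Propositional.Properties using (allFin⁺)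
open import Data.List.Relation.Binary.Permutation.Propositional
  using (_↭_; ↭-refl; ↭-trans; ↭-prep; ↭-swap; ↭-sym; ↭⇒↭ₛ)
open import Data.List.Relation.Binary.Permutation.Propositional.Properties using (∈-resp-↭; ↭-length)
open import Data.List.Relation.Binary.Permutation.Setoid.Properties using (Unique-resp-↭)
open import Data.Nat.Base using (ℕ; zero; suc; _+_; _*_; _∸_; _≡ᵇ_; _<_; _≤_; ⌊_/2⌋)
open import Data.Nat.Induction using (<-rec)
open import Data.Nat.Properties using (<ᵇ⇒<; <⇒<ᵇ; <-irrefl; <-asym; <-cmp)
import Data.Nat.Properties as ℕP
open import Data.Product.Base using (_×_; _,_; proj₁; proj₂; Σ; ∃; ∃₂; uncurry)
open import Data.Product.Properties using () renaming (≡-dec to ×-≡-dec)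
open import Data.Rational.Base using (ℚ; 0ℚ) renaming (_+_ to _+ℚ_; _<_ to _<ℚ_)
import Data.Rational.Base as ℚ
import Data.Rational.Properties as ℚP
open import Data.Sum.Base using (_⊎_; inj₁; inj₂)
import Data.Sum.Base as Sum
open import Data.Vec.Base using (Vec; lookup; tabulate; zipWith; replicate) renaming ([] to []ᵛ; _∷_ to _∷ᵛ_)
open import Data.Vec.Properties
  using (∷-injective; lookup-zipWith; lookup-replicate; lookup∘tabulate) renaming (≡-dec to Vec-≡-dec)
open import Data.Vec.Relation.Binary.Pointwise.Extensional using (ext; Pointwise-≡⇒≡)
open import Function.Base using (_∘_; _∘′_; id)
open import Function.Bundles using (_⇔_; mk⇔; Equivalence)
open import Level using (0ℓ)
open import Relation.Binary.Definitions using (DecidableEquality; Tri; tri<; tri≈; tri>)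
open import Relation.Binary.PropositionalEquality
open import Relation.Nullary using (¬_; Dec; yes; no; does; contradiction; ¬?)
open import Relation.Nullary.Decidable
  using (T?; does-≡; does-⇔; dec-true; dec-false; decidable-stable; toSum; _×-dec_; _⊎-dec_)
open import Relation.Unary using (Pred; Decidable)
open import Algebra.Definitions.RawMonoid ℚ.+-0-rawMonoid using () renaming (_×_ to _×ℚ_)
open import Algebra.Properties.Group ℚP.+-0-group using (identityʳ-unique)

open import Defs renaming (sym to Adj-sym; irrefl to Adj-irrefl)

private variable
  n : ℕ
  a b : Fin n
  A : Set

module ListSum {C : Set} {_∙_ : C → C → C} {ε : C} (isCM : IsCommutativeMonoid _≡_ _∙_ ε) where

  open IsCommutativeMonoid isCM using (assoc; comm; identityˡ; identityʳ)
  open ≡-Reasoning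

  ∑ : List A → (A → C) → C
  ∑ xs f = foldr _∙_ ε (map f xs)

  infixl 7 _when_
  _when_ : C → Bool → C
  c when b = if b then c else ε

  private variable
    B : Set

  ε-when : ∀ b → ε when b ≡ ε
  ε-when true  = refl
  ε-when false = refl

  ∑-cong : ∀ (xs : List A) {f g : A → C} → (∀ {x} → x ∈ xs → f x ≡ g x) → ∑ xs f ≡ ∑ xs g
  ∑-cong []       f≗g = refl
  ∑-cong (x ∷ xs) f≗g = cong₂ _∙_ (f≗g (here refl)) (∑-cong xs (f≗g ∘ there))

  ∑-zero : ∀ (xs : List A) {f : A → C} → (∀ {x} → x ∈ xs → f x ≡ ε) → ∑ xs f ≡ ε
  ∑-zero []       f≗0 = refl
  ∑-zero (x ∷ xs) f≗0 = trans (cong₂ _∙_ (f≗0 (here refl)) (∑-zero xs (f≗0 ∘ there))) (identityˡ ε)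

  ∑-∙ : ∀ (xs : List A) (f g : A → C) → ∑ xs (λ x → f x ∙ g x) ≡ ∑ xs f ∙ ∑ xs g
  ∑-∙ []       f g = sym (identityˡ ε)
  ∑-∙ (x ∷ xs) f g = begin
    (f x ∙ g x) ∙ ∑ xs (λ x → f x ∙ g x) ≡⟨ cong ((f x ∙ g x) ∙_) (∑-∙ xs f g) ⟩
    (f x ∙ g x) ∙ (F ∙ G)                ≡⟨ assoc (f x) (g x) (F ∙ G) ⟩
    f x ∙ (g x ∙ (F ∙ G))                ≡⟨ cong (f x ∙_) (sym (assoc (g x) F G)) ⟩
    f x ∙ ((g x ∙ F) ∙ G)                ≡⟨ cong (λ y → f x ∙ (y ∙ G)) (comm (g x) F) ⟩
    f x ∙ ((F ∙ g x) ∙ G)                ≡⟨ cong (f x ∙_) (assoc F (g x) G) ⟩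
    f x ∙ (F ∙ (g x ∙ G))                ≡⟨ sym (assoc (f x) F (g x ∙ G)) ⟩
    (f x ∙ F) ∙ (g x ∙ G)                ∎
    where
    F G : C
    F = ∑ xs f
    G = ∑ xs g

  ∑-comm : ∀ (xs : List A) (ys : List B) (h : A → B → C) →
           ∑ xs (λ x → ∑ ys (h x)) ≡ ∑ ys (λ y → ∑ xs (λ x → h x y))
  ∑-comm []       ys h = sym (∑-zero ys (λ _ → refl))
  ∑-comm (x ∷ xs) ys h =
    trans (cong (∑ ys (h x) ∙_) (∑-comm xs ys h)) (sym (∑-∙ ys (h x) _))

  ∑-map : ∀ (xs : List A) (f : A → B) (g : B → C) → ∑ (map f xs) g ≡ ∑ xs (g ∘ f)
  ∑-map []       f g = refl
  ∑-map (x ∷ xs) f g = cong (g (f x) ∙_) (∑-map xs f g)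

  ∑-++ : ∀ (xs ys : List A) (g : A → C) → ∑ (xs ++ ys) g ≡ ∑ xs g ∙ ∑ ys g
  ∑-++ []       ys g = sym (identityˡ _)
  ∑-++ (x ∷ xs) ys g = trans (cong (g x ∙_) (∑-++ xs ys g)) (sym (assoc _ _ _))

  ∑-concatMap : ∀ (xs : List A) (f : A → List B) (g : B → C) →
                ∑ (concatMap f xs) g ≡ ∑ xs (λ x → ∑ (f x) g)
  ∑-concatMap []       f g = refl
  ∑-concatMap (x ∷ xs) f g =
    trans (∑-++ (f x) (concatMap f xs) g) (cong (∑ (f x) g ∙_) (∑-concatMap xs f g))

  ∑-filter : ∀ {P : Pred A 0ℓ} (P? : Decidable P) (xs : List A) (g : A → C) →
             ∑ (filter P? xs) g ≡ ∑ xs (λ x → g x when does (P? x))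
  ∑-filter P? []       g = refl
  ∑-filter P? (x ∷ xs) g with does (P? x)
  ... | true  = cong (g x ∙_) (∑-filter P? xs g)
  ... | false = trans (∑-filter P? xs g) (sym (identityˡ _))

  ∑-filter-T : ∀ (p : A → Bool) (P? : ∀ x → Dec (T (p x))) (xs : List A) (g : A → C) →
               ∑ (filter P? xs) g ≡ ∑ xs (λ x → g x when p x)
  ∑-filter-T p P? xs g = trans (∑-filter P? xs g) (∑-cong xs λ {x} _ → cong (g x when_) (does-≡ (P? x) (T? (p x))))

  when-∑ : ∀ (b : Bool) (xs : List A) (f : A → C) → ∑ xs f when b ≡ ∑ xs (λ x → f x when b)
  when-∑ true  xs f = refl
  when-∑ false xs f = sym (∑-zero xs (λ _ → refl))

  ∑-allFin-point : ∀ n (g : Fin n → C) (a : Fin n) → (∀ v → v ≢ a → g v ≡ ε) → ∑ (allFin n) g ≡ g a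
  ∑-allFin-point n g a g≗0 = trans (cong (foldr _∙_ ε) (map-tabulate id g)) (tabulate-point n g a g≗0)
    where
    tabulate-zero : ∀ m (f : Fin m → C) → (∀ v → f v ≡ ε) → foldr _∙_ ε (List.tabulate f) ≡ ε
    tabulate-zero zero    f f≗0 = refl
    tabulate-zero (suc m) f f≗0 =
      trans (cong₂ _∙_ (f≗0 zero) (tabulate-zero m (f ∘ suc) (f≗0 ∘ suc))) (identityˡ ε)
    tabulate-point : ∀ m (f : Fin m → C) (a : Fin m) → (∀ v → v ≢ a → f v ≡ ε) →
                     foldr _∙_ ε (List.tabulate f) ≡ f a
    tabulate-point (suc m) f zero f≗0 =
      trans (cong (f zero ∙_) (tabulate-zero m (f ∘ suc) (λ v → f≗0 (suc v) (λ ())))) (identityʳ _)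
    tabulate-point (suc m) f (suc a) f≗0 =
      trans (cong₂ _∙_ (f≗0 zero (λ ())) (tabulate-point m (f ∘ suc) a (λ v v≢a → f≗0 (suc v) (v≢a ∘ suc-injective))))
            (identityˡ _)

  ∑-allVecs-point : ∀ {n} k (g : Vec (Fin n) k → C) (a : Vec (Fin n) k) →
                    (∀ v → v ≢ a → g v ≡ ε) → ∑ (allVecs k n) g ≡ g a
  ∑-allVecs-point zero    g []ᵛ       g≗0 = identityʳ (g []ᵛ)
  ∑-allVecs-point {n} (suc k) g (a ∷ᵛ as) g≗0 = begin
    ∑ (allVecs (suc k) n) g
      ≡⟨ ∑-concatMap (allVecs k n) (λ vs → map (_∷ᵛ vs) (allFin n)) g ⟩
    ∑ (allVecs k n) (λ vs → ∑ (map (_∷ᵛ vs) (allFin n)) g)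
      ≡⟨ ∑-allVecs-point k _ as tail≢ ⟩
    ∑ (map (_∷ᵛ as) (allFin n)) g
      ≡⟨ ∑-map (allFin n) (_∷ᵛ as) g ⟩
    ∑ (allFin n) (λ v → g (v ∷ᵛ as))
      ≡⟨ ∑-allFin-point n _ a (λ v v≢a → g≗0 _ (v≢a ∘ proj₁ ∘ ∷-injective)) ⟩
    g (a ∷ᵛ as) ∎
    where
    tail≢ : ∀ vs → vs ≢ as → ∑ (map (_∷ᵛ vs) (allFin n)) g ≡ ε
    tail≢ vs vs≢as = trans (∑-map (allFin n) (_∷ᵛ vs) g)
                           (∑-zero (allFin n) (λ {v} _ → g≗0 _ (vs≢as ∘ proj₂ ∘ ∷-injective)))

module ℕΣ = ListSum ℕP.+-0-isCommutativeMonoid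
module ℚΣ = ListSum ℚP.+-0-isCommutativeMonoid

==F-refl : (a : Fin n) → (a ==F a) ≡ true
==F-refl a = dec-true (a ≟F a) refl

==F-≢ : a ≢ b → (a ==F b) ≡ false
==F-≢ {a = a} {b} = dec-false (a ≟F b)

==F-sound : (a ==F b) ≡ true → a ≡ b
==F-sound {a = a} {b} a==b with a ≟F b
... | yes a≡b = a≡b

==F-sym : (a b : Fin n) → (a ==F b) ≡ (b ==F a)
==F-sym a b with a ≟F b
... | yes refl = sym (==F-refl a)
... | no a≢b   = sym (==F-≢ (a≢b ∘ sym))

==F-false⇒≢ : (a ==F b) ≡ false → a ≢ b
==F-false⇒≢ {a = a} a≠b refl = contradiction (trans (sym (==F-refl a)) a≠b) λ ()

==F∧==F-sound : ∀ {c d : Fin n} → (a ==F c ∧ b ==F d) ≡ true → a ≡ c × b ≡ d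
==F∧==F-sound eq = ==F-sound (∧-conicalˡ _ _ eq) , ==F-sound (∧-conicalʳ _ _ eq)

<F⇒< : (a <F b) ≡ true → toℕ a < toℕ b
<F⇒< {a = a} {b} a<b = <ᵇ⇒< (toℕ a) (toℕ b) (Equivalence.from T-≡ a<b)

<⇒<F : toℕ a < toℕ b → (a <F b) ≡ true
<⇒<F a<b = Equivalence.to T-≡ (<⇒<ᵇ a<b)

≮⇒<F-false : ¬ toℕ a < toℕ b → (a <F b) ≡ false
≮⇒<F-false {a = a} {b} a≮b with a <F b in a<b
... | true  = contradiction (<F⇒< a<b) a≮b
... | false = refl

<F-asym : (a b : Fin n) → (a <F b) ≡ true → (b <F a) ≡ false
<F-asym a b a<b = ≮⇒<F-false {a = b} {a} (<-asym (<F⇒< {a = a} {b} a<b))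

<F-connex : a ≢ b → (a <F b) ≡ false → (b <F a) ≡ true
<F-connex {a = a} {b} a≢b a≮b with <-cmp (toℕ a) (toℕ b)
... | tri< a<b _ _ = contradiction (trans (sym (<⇒<F {a = a} {b} a<b)) a≮b) λ ()
... | tri≈ _ a≡b _ = contradiction (toℕ-injective a≡b) a≢b
... | tri> _ _ b<a = <⇒<F {a = b} {a} b<a

<F-irrefl : (a : Fin n) → (a <F a) ≡ false
<F-irrefl a = ≮⇒<F-false {a = a} {a} (<-irrefl refl)

<F∧==F-false : (a b : Fin n) → (a <F b ∧ a ==F b) ≡ false
<F∧==F-false a b with a ≟F b
... | yes refl rewrite <F-irrefl a = refl
... | no _     = ∧-zeroʳ (a <F b)

lo<hi : a ≢ b → (lo a b <F hi a b) ≡ true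
lo<hi {a = a} {b} a≢b with a <F b in a<b
... | true  = a<b
... | false = <F-connex a≢b a<b

lo-≡ˡ : (a b : Fin n) → (a <F b) ≡ true → lo a b ≡ a
lo-≡ˡ a b a<b = cong (if_then a else b) a<b

hi-≡ʳ : (a b : Fin n) → (a <F b) ≡ true → hi a b ≡ b
hi-≡ʳ a b a<b = cong (if_then b else a) a<b

lo-≡ʳ : (a b : Fin n) → (a <F b) ≡ false → lo a b ≡ b
lo-≡ʳ a b a≮b = cong (if_then a else b) a≮b

hi-≡ˡ : (a b : Fin n) → (a <F b) ≡ false → hi a b ≡ a
hi-≡ˡ a b a≮b = cong (if_then b else a) a≮b

lo-comm : a ≢ b → lo a b ≡ lo b a
lo-comm {a = a} {b} a≢b with a <F b in a<b
... | true  = sym (lo-≡ʳ b a (<F-asym a b a<b))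
... | false = sym (lo-≡ˡ b a (<F-connex a≢b a<b))

hi-comm : a ≢ b → hi a b ≡ hi b a
hi-comm {a = a} {b} a≢b with a <F b in a<b
... | true  = sym (hi-≡ˡ b a (<F-asym a b a<b))
... | false = sym (hi-≡ʳ b a (<F-connex a≢b a<b))

lo-∈ : (a b : Fin n) → lo a b ≡ a ⊎ lo a b ≡ b
lo-∈ a b with a <F b
... | true  = inj₁ refl
... | false = inj₂ refl

Adj-lo-hi : (G : SimpleGraph n) (u v : Fin n) → Adj G (lo u v) (hi u v) ≡ Adj G u v
Adj-lo-hi G u v with u <F v
... | true  = refl
... | false = Adj-sym G v u

-- Pfaffians under a substitution of monomials

mapMon : {M M′ : Set} → (M → M′) → Poly M → Poly M′
mapMon φ = map (λ t → (φ (proj₁ t) , proj₂ t))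

module PolyMap {M M′ : Set} (ε : M) (_·_ : M → M → M) (ε′ : M′) (_·′_ : M′ → M′ → M′)
               (φ : M → M′) (φ-ε : φ ε ≡ ε′) (φ-· : ∀ a b → φ (a · b) ≡ φ a ·′ φ b) where

  private
    module O  = PolyOps ε _·_
    module O′ = PolyOps ε′ _·′_

  mapMon-scaleP : ∀ c p → mapMon φ (O.scaleP c p) ≡ O′.scaleP c (mapMon φ p)
  mapMon-scaleP c []      = refl
  mapMon-scaleP c (t ∷ p) = cong (_ ∷_) (mapMon-scaleP c p)

  mapMon-sumP : ∀ ps → mapMon φ (O.sumP ps) ≡ O′.sumP (map (mapMon φ) ps)
  mapMon-sumP []       = refl
  mapMon-sumP (p ∷ ps) = trans (map-++ _ p (O.sumP ps)) (cong (mapMon φ p ++_) (mapMon-sumP ps))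

  mapMon-⊗ : ∀ p q → mapMon φ (p O.⊗ q) ≡ mapMon φ p O′.⊗ mapMon φ q
  mapMon-⊗ []      q = refl
  mapMon-⊗ (s ∷ p) q = trans (map-++ _ (scaled q) (p O.⊗ q)) (cong₂ _++_ (row q) (mapMon-⊗ p q))
    where
    scaled : Poly M → Poly M
    scaled = map (λ t → (proj₁ s · proj₁ t , proj₂ s ℚ.* proj₂ t))
    row : ∀ q → mapMon φ (scaled q) ≡ map (λ t → (φ (proj₁ s) ·′ proj₁ t , proj₂ s ℚ.* proj₂ t)) (mapMon φ q)
    row []      = refl
    row (t ∷ q) = cong₂ _∷_ (cong (_, _) (φ-· _ _)) (row q)

  mapMon-prodP : ∀ ps → mapMon φ (O.prodP ps) ≡ O′.prodP (map (mapMon φ) ps)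
  mapMon-prodP []       = cong (λ m → (m , _) ∷ []) φ-ε
  mapMon-prodP (p ∷ ps) = trans (mapMon-⊗ p (O.prodP ps)) (cong (mapMon φ p O′.⊗_) (mapMon-prodP ps))

  Pf-mapMon : ∀ n (B : Fin n → Fin n → Poly M) (B′ : Fin n → Fin n → Poly M′) →
              (∀ u v → B′ u v ≡ mapMon φ (B u v)) → O′.Pf n B′ ≡ mapMon φ (O.Pf n B)
  Pf-mapMon n B B′ B′≡φB = sym (begin
    mapMon φ (O.Pf n B)
      ≡⟨ mapMon-scaleP norm (O.sumP (map term (perms (allFin n)))) ⟩
    O′.scaleP norm (mapMon φ (O.sumP (map term (perms (allFin n)))))
      ≡⟨ cong (O′.scaleP norm) (mapMon-sumP (map term (perms (allFin n)))) ⟩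
    O′.scaleP norm (O′.sumP (map (mapMon φ) (map term (perms (allFin n)))))
      ≡⟨ cong (O′.scaleP norm ∘′ O′.sumP)
              (trans (sym (map-∘ (perms (allFin n)))) (map-cong term-mapMon (perms (allFin n)))) ⟩
    O′.Pf n B′ ∎)
    where
    open ≡-Reasoning
    norm : ℚ
    norm = pfNorm ⌊ n /2⌋
    sign : List (Fin n) → ℚ
    sign σ = signℚ (inversions σ)
    entries : List (Fin n × Fin n) → List (Poly M)
    entries = map (uncurry B)
    term : List (Fin n) → Poly M
    term σ = O.scaleP (sign σ) (O.prodP (entries (pairsOf σ)))
    term-mapMon : ∀ σ → mapMon φ (term σ) ≡ O′.scaleP (sign σ) (O′.prodP (map (uncurry B′) (pairsOf σ)))
    term-mapMon σ = begin
      mapMon φ (term σ)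
        ≡⟨ mapMon-scaleP (sign σ) (O.prodP (entries (pairsOf σ))) ⟩
      O′.scaleP (sign σ) (mapMon φ (O.prodP (entries (pairsOf σ))))
        ≡⟨ cong (O′.scaleP (sign σ)) (mapMon-prodP (entries (pairsOf σ))) ⟩
      O′.scaleP (sign σ) (O′.prodP (map (mapMon φ) (entries (pairsOf σ))))
        ≡⟨ cong (O′.scaleP (sign σ) ∘′ O′.prodP)
                (trans (sym (map-∘ (pairsOf σ))) (map-cong (λ p → sym (B′≡φB (proj₁ p) (proj₂ p))) (pairsOf σ))) ⟩
      O′.scaleP (sign σ) (O′.prodP (map (uncurry B′) (pairsOf σ))) ∎

module PolyMembership {M : Set} (ε : M) (_·_ : M → M → M) where

  open PolyOps ε _·_

  ∈-scaleP⁻ : ∀ c {p t} → t ∈ scaleP c p → ∃ λ t′ → t′ ∈ p × proj₁ t ≡ proj₁ t′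
  ∈-scaleP⁻ c t∈ with ∈-map⁻ (λ t → (proj₁ t , c ℚ.* proj₂ t)) t∈
  ... | t′ , t′∈ , refl = t′ , t′∈ , refl

  ∈-⊗⁻ : ∀ {p q t} → t ∈ p ⊗ q → ∃₂ λ s t′ → s ∈ p × t′ ∈ q × proj₁ t ≡ proj₁ s · proj₁ t′
  ∈-⊗⁻ {p} t∈ with find (∈-concatMap⁻ _ {xs = p} t∈)
  ... | s , s∈ , t∈row with ∈-map⁻ _ t∈row
  ... | t′ , t′∈ , refl = s , t′ , s∈ , t′∈ , refl

  ∈-Pf⁻ : ∀ {n B t} → t ∈ Pf n B →
          ∃₂ λ σ t′ → σ ∈ perms (allFin n) × t′ ∈ prodP (map (uncurry B) (pairsOf σ)) × proj₁ t ≡ proj₁ t′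
  ∈-Pf⁻ {n} {B} t∈ with ∈-scaleP⁻ (pfNorm ⌊ n /2⌋) t∈
  ... | t₁ , t₁∈ , t≡t₁ with find (∈-concatMap⁻ _ {xs = perms (allFin n)} t₁∈)
  ... | σ , σ∈ , t₁∈term with ∈-scaleP⁻ (signℚ (inversions σ)) t₁∈term
  ... | t′ , t′∈ , t₁≡t′ = σ , t′ , σ∈ , t′∈ , trans t≡t₁ t₁≡t′

-- Monomials in the edge variables and perfect matchings

indicator : Bool → ℕ
indicator b = if b then 1 else 0

indicator-≡1 : ∀ {b} → indicator b ≡ 1 → b ≡ true
indicator-≡1 {true} _ = refl

indicator-<F-connex : a ≢ b → indicator (a <F b) + indicator (b <F a) ≡ 1
indicator-<F-connex {a = a} {b} a≢b with a <F b in a<b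
... | true  = cong (suc ∘ indicator) (<F-asym a b a<b)
... | false = cong indicator (<F-connex a≢b a<b)

εX : MonX n
εX = replicate _ (replicate _ 0)

infixl 7 _·X_
_·X_ : MonX n → MonX n → MonX n
_·X_ = zipWith (zipWith _+_)

exponent : MonX n → Fin n → Fin n → ℕ
exponent mon a b = lookup (lookup mon a) b

monomial-ext : (mon mon′ : MonX n) → (∀ a b → exponent mon a b ≡ exponent mon′ a b) → mon ≡ mon′
monomial-ext mon mon′ same = Pointwise-≡⇒≡ (ext λ a → Pointwise-≡⇒≡ (ext (same a)))

exponent-ε : (a b : Fin n) → exponent εX a b ≡ 0
exponent-ε {n} a b = trans (cong (λ row → lookup row b) (lookup-replicate a (replicate n 0))) (lookup-replicate b 0)

exponent-· : (mon mon′ : MonX n) (a b : Fin n) → exponent (mon ·X mon′) a b ≡ exponent mon a b + exponent mon′ a b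
exponent-· mon mon′ a b = trans (cong (λ row → lookup row b) (lookup-zipWith (zipWith _+_) a mon mon′))
                                (lookup-zipWith _+_ b (lookup mon a) (lookup mon′ a))

exponent-tabulate : (f : Fin n → Fin n → ℕ) (a b : Fin n) →
                    exponent (tabulate (λ a → tabulate (f a))) a b ≡ f a b
exponent-tabulate f a b = trans (cong (λ row → lookup row b) (lookup∘tabulate (λ a → tabulate (f a)) a))
                                (lookup∘tabulate (f a) b)

exponent-xVar : (i j a b : Fin n) → exponent (xVar i j) a b ≡ indicator (a ==F i ∧ b ==F j)
exponent-xVar i j = exponent-tabulate (λ a b → indicator (a ==F i ∧ b ==F j))

exponent-pmMonomial : (m : Vec (Fin n) n) (a b : Fin n) →
                      exponent (pmMonomial m) a b ≡ indicator (a <F b ∧ lookup m a ==F b)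
exponent-pmMonomial m = exponent-tabulate (λ a b → indicator (a <F b ∧ lookup m a ==F b))

record IsPerfectMatching (G : SimpleGraph n) (mate : Fin n → Fin n) : Set where
  field
    mate-≢    : ∀ u → mate u ≢ u
    mate-mate : ∀ u → mate (mate u) ≡ u
    mate-adj  : ∀ u → Adj G u (mate u) ≡ true

module _ (p : A → Bool) where

  allᵇ-sound : ∀ xs → T (allᵇ p xs) → ∀ {x} → x ∈ xs → T (p x)
  allᵇ-sound (y ∷ xs) all (here refl) = proj₁ (Equivalence.to T-∧ all)
  allᵇ-sound (y ∷ xs) all (there x∈)  = allᵇ-sound xs (proj₂ (Equivalence.to T-∧ all)) x∈

  allᵇ-complete : ∀ xs → (∀ {x} → x ∈ xs → T (p x)) → T (allᵇ p xs)
  allᵇ-complete []       every = _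
  allᵇ-complete (x ∷ xs) every = Equivalence.from T-∧ (every (here refl) , allᵇ-complete xs (every ∘ there))

T-∧₃ : ∀ {x y z} → T (x ∧ y ∧ z) ⇔ (T x × T y × T z)
T-∧₃ {x} = mk⇔ (λ t → let (tx , tyz) = Equivalence.to (T-∧ {x}) t in tx , Equivalence.to T-∧ tyz)
               (λ (tx , ty , tz) → Equivalence.from T-∧ (tx , Equivalence.from T-∧ (ty , tz)))

mateConditionᵇ : SimpleGraph n → Vec (Fin n) n → Fin n → Bool
mateConditionᵇ G m u = not (lookup m u ==F u) ∧ (lookup m (lookup m u) ==F u) ∧ Adj G u (lookup m u)

isPMᵇ-sound : (G : SimpleGraph n) (m : Vec (Fin n) n) → T (isPMᵇ G m) → IsPerfectMatching G (lookup m)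
isPMᵇ-sound G m isPM = record
  { mate-≢    = λ u → ==F-false⇒≢ (Equivalence.to T-not-≡ (proj₁ (at u)))
  ; mate-mate = λ u → ==F-sound (Equivalence.to T-≡ (proj₁ (proj₂ (at u))))
  ; mate-adj  = λ u → Equivalence.to T-≡ (proj₂ (proj₂ (at u)))
  }
  where
  at : ∀ u → T (not (lookup m u ==F u)) × T (lookup m (lookup m u) ==F u) × T (Adj G u (lookup m u))
  at u = Equivalence.to T-∧₃ (allᵇ-sound (mateConditionᵇ G m) (allFin _) isPM (∈-allFin u))

isPMᵇ-complete : (G : SimpleGraph n) (mate : Fin n → Fin n) → IsPerfectMatching G mate → T (isPMᵇ G (tabulate mate))
isPMᵇ-complete G mate isPM = allᵇ-complete (mateConditionᵇ G (tabulate mate)) (allFin _) (λ {u} _ → at u)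
  where
  open IsPerfectMatching isPM
  at : ∀ u → T (mateConditionᵇ G (tabulate mate) u)
  at u rewrite lookup∘tabulate mate u | lookup∘tabulate mate (mate u) =
    Equivalence.from T-∧₃ ( Equivalence.from T-not-≡ (==F-≢ (mate-≢ u))
                          , Equivalence.from T-≡ (trans (cong (_==F u) (mate-mate u)) (==F-refl u))
                          , Equivalence.from T-≡ (mate-adj u))

module _ {G : SimpleGraph n} (m : Vec (Fin n) n) (isPM : IsPerfectMatching G (lookup m)) where

  open IsPerfectMatching isPM

  mate-==F-comm : (u v : Fin n) → (lookup m v ==F u) ≡ (lookup m u ==F v)
  mate-==F-comm u v with lookup m u ≟F v
  ... | yes refl = trans (cong (_==F u) (mate-mate u)) (==F-refl u)
  ... | no mu≢v  = ==F-≢ λ mv≡u → mu≢v (trans (cong (lookup m) (sym mv≡u)) (mate-mate v))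

  inPM-lo-hi : (u v : Fin n) → inPM m (lo u v) (hi u v) ≡ (lookup m u ==F v)
  inPM-lo-hi u v with u <F v
  ... | true  = refl
  ... | false = mate-==F-comm u v

  exponent-pmMonomial-lo-hi : (u v : Fin n) → exponent (pmMonomial m) (lo u v) (hi u v) ≡ 1 ⇔ lookup m u ≡ v
  exponent-pmMonomial-lo-hi u v = mk⇔ to from
    where
    to : exponent (pmMonomial m) (lo u v) (hi u v) ≡ 1 → lookup m u ≡ v
    to e≡1 = ==F-sound (trans (sym (inPM-lo-hi u v))
               (∧-conicalʳ _ _ (indicator-≡1 (trans (sym (exponent-pmMonomial m (lo u v) (hi u v))) e≡1))))
    from : lookup m u ≡ v → exponent (pmMonomial m) (lo u v) (hi u v) ≡ 1
    from refl = begin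
      exponent (pmMonomial m) (lo u v) (hi u v)
        ≡⟨ exponent-pmMonomial m (lo u v) (hi u v) ⟩
      indicator (lo u v <F hi u v ∧ inPM m (lo u v) (hi u v))
        ≡⟨ cong₂ (λ b c → indicator (b ∧ c)) (lo<hi (mate-≢ u ∘ sym)) (inPM-lo-hi u v) ⟩
      indicator (lookup m u ==F v)
        ≡⟨ cong indicator (==F-refl v) ⟩
      1 ∎
      where open ≡-Reasoning

pmMonomial-injective : {G : SimpleGraph n} {m m′ : Vec (Fin n) n} →
                       IsPerfectMatching G (lookup m) → IsPerfectMatching G (lookup m′) →
                       pmMonomial m ≡ pmMonomial m′ → m ≡ m′
pmMonomial-injective {m = m} {m′} isPM isPM′ same = Pointwise-≡⇒≡ (ext λ u →
  let v = lookup m u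
      edge-in-m  = Equivalence.from (exponent-pmMonomial-lo-hi m isPM u v) refl
      edge-in-m′ = trans (cong (λ mon → exponent mon (lo u v) (hi u v)) (sym same)) edge-in-m
  in sym (Equivalence.to (exponent-pmMonomial-lo-hi m′ isPM′ u v) edge-in-m′))

module _ where

  open ℕΣ using (∑; _when_)

  ∑-allFin-involution : (f : Fin n → Fin n) → (∀ u → f (f u) ≡ u) → (g : Fin n → ℕ) →
                        ∑ (allFin n) (g ∘ f) ≡ ∑ (allFin n) g
  ∑-allFin-involution {n} f f-invol g = begin
    ∑ (allFin n) (g ∘ f)                                   ≡⟨ ℕΣ.∑-cong (allFin n) (λ {u} _ → sym (select-f u)) ⟩
    ∑ (allFin n) (λ u → ∑ (allFin n) (λ v → selected u v)) ≡⟨ ℕΣ.∑-comm (allFin n) (allFin n) selected ⟩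
    ∑ (allFin n) (λ v → ∑ (allFin n) (λ u → selected u v)) ≡⟨ ℕΣ.∑-cong (allFin n) (λ {v} _ → select-f⁻¹ v) ⟩
    ∑ (allFin n) g                                         ∎
    where
    open ≡-Reasoning
    selected : Fin n → Fin n → ℕ
    selected u v = g v when (v ==F f u)
    select-f : ∀ u → ∑ (allFin n) (selected u) ≡ g (f u)
    select-f u = trans (ℕΣ.∑-allFin-point n (selected u) (f u) λ v v≢fu → cong (g v when_) (==F-≢ v≢fu))
                       (cong (g (f u) when_) (==F-refl (f u)))
    select-f⁻¹ : ∀ v → ∑ (allFin n) (λ u → selected u v) ≡ g v
    select-f⁻¹ v = trans (ℕΣ.∑-allFin-point n (λ u → selected u v) (f v) λ u u≢fv → cong (g v when_) (==F-≢ (v≢fu u≢fv)))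
                         (cong (g v when_) (trans (cong (v ==F_) (f-invol v)) (==F-refl v)))
      where
      v≢fu : ∀ {u} → u ≢ f v → v ≢ f u
      v≢fu {u} u≢fv v≡fu = u≢fv (trans (sym (f-invol u)) (cong f (sym v≡fu)))

  -- Each orbit {u , f u} has exactly one ascent u < f u, so n is twice the number of ascents.
  involution-even : (f : Fin n → Fin n) → (∀ u → f (f u) ≡ u) → (∀ u → f u ≢ u) → ∃ λ k → n ≡ k + k
  involution-even {n} f f-invol f-≢ = ascents , (begin
    n                                                ≡⟨ sym count-all ⟩
    ∑ (allFin n) (λ _ → 1)                           ≡⟨ ℕΣ.∑-cong (allFin n) (λ {u} _ → sym (ascent+descent u)) ⟩
    ∑ (allFin n) (λ u → ascent u + ascent (f u))     ≡⟨ ℕΣ.∑-∙ (allFin n) ascent (ascent ∘ f) ⟩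
    ascents + ∑ (allFin n) (ascent ∘ f)              ≡⟨ cong (_+_ ascents) (∑-allFin-involution f f-invol ascent) ⟩
    ascents + ascents                                ∎)
    where
    open ≡-Reasoning
    ascent : Fin n → ℕ
    ascent u = indicator (u <F f u)
    ascents : ℕ
    ascents = ∑ (allFin n) ascent
    ascent+descent : ∀ u → ascent u + ascent (f u) ≡ 1
    ascent+descent u = trans (cong (λ v → ascent u + indicator (f u <F v)) (f-invol u))
                             (indicator-<F-connex (f-≢ u ∘ sym))
    count-all : ∑ (allFin n) (λ _ → 1) ≡ n
    count-all = trans (∑-const (allFin n)) (length-tabulate id)
      where
      ∑-const : (xs : List (Fin n)) → ∑ xs (λ _ → 1) ≡ length xs
      ∑-const []       = refl
      ∑-const (x ∷ xs) = cong suc (∑-const xs)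

-- Weights of monomials, and the substitutions giving A and A_e

module _ where

  open ℕΣ using (∑; _when_)

  ∑-allFin²-select : (h : Fin n → Fin n → ℕ) (i j : Fin n) →
                     ∑ (allFin n) (λ a → ∑ (allFin n) (λ b → h a b when (a ==F i ∧ b ==F j))) ≡ h i j
  ∑-allFin²-select {n} h i j =
    trans (ℕΣ.∑-allFin-point n _ i λ a a≢i →
             ℕΣ.∑-zero (allFin n) λ {b} _ → cong (λ c → h a b when (c ∧ b ==F j)) (==F-≢ a≢i))
          (trans (ℕΣ.∑-cong (allFin n) (λ {b} _ → cong (λ c → h i b when (c ∧ b ==F j)) (==F-refl i)))
                 (trans (ℕΣ.∑-allFin-point n _ j (λ b b≢j → cong (h i b when_) (==F-≢ b≢j)))
                        (cong (h i j when_) (==F-refl j))))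

  indicator-* : ∀ b x → indicator b * x ≡ x when b
  indicator-* true  x = ℕP.+-identityʳ x
  indicator-* false x = refl

  weight : (Fin n → Fin n → ℕ) → MonX n → ℕ
  weight {n} W mon = ∑ (allFin n) λ a → ∑ (allFin n) λ b → exponent mon a b * W a b

  clearWeight : (Fin n → Fin n → ℕ) → Fin n → Fin n → Fin n → Fin n → ℕ
  clearWeight W i j a b = if a ==F i ∧ b ==F j then 0 else W a b

  module _ (W : Fin n → Fin n → ℕ) where

    weight-ε : weight W εX ≡ 0
    weight-ε = ℕΣ.∑-zero (allFin n) λ {a} _ → ℕΣ.∑-zero (allFin n) λ {b} _ → cong (_* W a b) (exponent-ε a b)

    weight-· : ∀ mon mon′ → weight W (mon ·X mon′) ≡ weight W mon + weight W mon′
    weight-· mon mon′ = trans (ℕΣ.∑-cong (allFin n) λ {a} _ → trans (ℕΣ.∑-cong (allFin n) λ {b} _ → distrib a b)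
                                                                    (ℕΣ.∑-∙ (allFin n) _ _))
                              (ℕΣ.∑-∙ (allFin n) _ _)
      where
      distrib : ∀ a b → exponent (mon ·X mon′) a b * W a b ≡ exponent mon a b * W a b + exponent mon′ a b * W a b
      distrib a b = trans (cong (_* W a b) (exponent-· mon mon′ a b))
                          (ℕP.*-distribʳ-+ (W a b) (exponent mon a b) (exponent mon′ a b))

    weight-xVar : ∀ i j → weight W (xVar i j) ≡ W i j
    weight-xVar i j = trans (ℕΣ.∑-cong (allFin n) λ {a} _ → ℕΣ.∑-cong (allFin n) λ {b} _ →
                               trans (cong (_* W a b) (exponent-xVar i j a b)) (indicator-* _ (W a b)))
                            (∑-allFin²-select W i j)

    weight-pmMonomial : ∀ m → weight W (pmMonomial m) ≡ weightPM W m
    weight-pmMonomial m = ℕΣ.∑-cong (allFin n) λ {a} _ →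
      trans (ℕΣ.∑-allFin-point n _ (lookup m a) (λ b b≢ma → off-mate a b b≢ma)) (at-mate a)
      where
      off-mate : ∀ a b → b ≢ lookup m a → exponent (pmMonomial m) a b * W a b ≡ 0
      off-mate a b b≢ma = begin
        exponent (pmMonomial m) a b * W a b
          ≡⟨ cong (_* W a b) (exponent-pmMonomial m a b) ⟩
        indicator (a <F b ∧ lookup m a ==F b) * W a b
          ≡⟨ cong (λ c → indicator (a <F b ∧ c) * W a b) (==F-≢ (b≢ma ∘ sym)) ⟩
        indicator (a <F b ∧ false) * W a b
          ≡⟨ cong (λ c → indicator c * W a b) (∧-zeroʳ (a <F b)) ⟩
        0 ∎
        where open ≡-Reasoning
      at-mate : ∀ a → exponent (pmMonomial m) a (lookup m a) * W a (lookup m a) ≡ (if a <F lookup m a then W a (lookup m a) else 0)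
      at-mate a with a <F lookup m a in a<ma
      ... | true  = trans (cong (_* W a (lookup m a)) (trans (exponent-pmMonomial m a (lookup m a))
                            (cong₂ (λ c d → indicator (c ∧ d)) a<ma (==F-refl (lookup m a))))) (ℕP.+-identityʳ _)
      ... | false = cong (_* W a (lookup m a)) (trans (exponent-pmMonomial m a (lookup m a))
                                                     (cong (λ c → indicator (c ∧ lookup m a ==F lookup m a)) a<ma))

    weight-clearWeight : ∀ i j mon → weight W mon ≡ weight (clearWeight W i j) mon + exponent mon i j * W i j
    weight-clearWeight i j mon = begin
      weight W mon
        ≡⟨ ℕΣ.∑-cong (allFin n) (λ {a} _ → ℕΣ.∑-cong (allFin n) λ {b} _ → split a b) ⟩
      ∑ (allFin n) (λ a → ∑ (allFin n) λ b → exponent mon a b * clearWeight W i j a b + term a b when (a ==F i ∧ b ==F j))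
        ≡⟨ ℕΣ.∑-cong (allFin n) (λ {a} _ → ℕΣ.∑-∙ (allFin n) _ _) ⟩
      ∑ (allFin n) (λ a → ∑ (allFin n) (λ b → exponent mon a b * clearWeight W i j a b)
                          + ∑ (allFin n) λ b → term a b when (a ==F i ∧ b ==F j))
        ≡⟨ ℕΣ.∑-∙ (allFin n) _ _ ⟩
      weight (clearWeight W i j) mon + ∑ (allFin n) (λ a → ∑ (allFin n) λ b → term a b when (a ==F i ∧ b ==F j))
        ≡⟨ cong (_+_ (weight (clearWeight W i j) mon)) (∑-allFin²-select term i j) ⟩
      weight (clearWeight W i j) mon + exponent mon i j * W i j ∎
      where
      open ≡-Reasoning
      term : Fin n → Fin n → ℕ
      term a b = exponent mon a b * W a b
      split : ∀ a b → term a b ≡ exponent mon a b * clearWeight W i j a b + term a b when (a ==F i ∧ b ==F j)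
      split a b with a ==F i ∧ b ==F j
      ... | true  = sym (cong (_+ term a b) (ℕP.*-zeroʳ (exponent mon a b)))
      ... | false = sym (ℕP.+-identityʳ (term a b))

sameEdgeᵇ : Fin n → Fin n → Fin n → Fin n → Bool
sameEdgeᵇ i j u v = u ==F i ∧ v ==F j ∨ u ==F j ∧ v ==F i

module _ {i j : Fin n} (i<j : (i <F j) ≡ true) where

  lo-hi-≡ : (u v : Fin n) → (lo u v ≡ i × hi u v ≡ j) ⇔ ((u ≡ i × v ≡ j) ⊎ (u ≡ j × v ≡ i))
  lo-hi-≡ u v = mk⇔ to from
    where
    to : lo u v ≡ i × hi u v ≡ j → (u ≡ i × v ≡ j) ⊎ (u ≡ j × v ≡ i)
    to with u <F v
    ... | true  = inj₁
    ... | false = λ (v≡i , u≡j) → inj₂ (u≡j , v≡i)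
    from : (u ≡ i × v ≡ j) ⊎ (u ≡ j × v ≡ i) → lo u v ≡ i × hi u v ≡ j
    from (inj₁ (refl , refl)) = lo-≡ˡ i j i<j , hi-≡ʳ i j i<j
    from (inj₂ (refl , refl)) = lo-≡ʳ j i (<F-asym i j i<j) , hi-≡ˡ j i (<F-asym i j i<j)

  lo-hi-==F : (u v : Fin n) → (lo u v ==F i ∧ hi u v ==F j) ≡ sameEdgeᵇ i j u v
  lo-hi-==F u v = does-⇔ (lo-hi-≡ u v) ((lo u v ≟F i) ×-dec (hi u v ≟F j))
                                       (((u ≟F i) ×-dec (v ≟F j)) ⊎-dec ((u ≟F j) ×-dec (v ≟F i)))

module Weighting (G : SimpleGraph n) (T′ : Fin n → Fin n → ℚ) (W : Fin n → Fin n → ℕ) where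

  -- the substitutions on monomials that carry T′_X to A, and to A_e for e = {i , j}
  zWeight : MonX n → Mon₂
  zWeight mon = (weight W mon , 0)

  weighted≡mapMon : ∀ u v → weighted G T′ W u v ≡ mapMon zWeight (tutteX G T′ u v)
  weighted≡mapMon u v with Adj G u v
  ... | true  = cong (λ w → ((w , 0) , T′ u v) ∷ []) (sym (weight-xVar W (lo u v) (hi u v)))
  ... | false = refl

  module _ (i j : Fin n) where

    zyWeight : MonX n → Mon₂
    zyWeight mon = (weight (clearWeight W i j) mon , exponent mon i j)

    zyWeight-xVar : (i <F j) ≡ true → ∀ u v →
                    zyWeight (xVar (lo u v) (hi u v)) ≡ (if sameEdgeᵇ i j u v then (0 , 1) else (wt W u v , 0))
    zyWeight-xVar i<j u v = begin
      zyWeight (xVar (lo u v) (hi u v))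
        ≡⟨ cong₂ _,_ (weight-xVar (clearWeight W i j) (lo u v) (hi u v)) (exponent-xVar (lo u v) (hi u v) i j) ⟩
      (clearWeight W i j (lo u v) (hi u v) , indicator (i ==F lo u v ∧ j ==F hi u v))
        ≡⟨ cong (λ c → (clearWeight W i j (lo u v) (hi u v) , indicator c))
                (cong₂ _∧_ (==F-sym i (lo u v)) (==F-sym j (hi u v))) ⟩
      ((if lo u v ==F i ∧ hi u v ==F j then 0 else wt W u v) , indicator (lo u v ==F i ∧ hi u v ==F j))
        ≡⟨ cong (λ c → ((if c then 0 else wt W u v) , indicator c)) (lo-hi-==F i<j u v) ⟩
      ((if sameEdgeᵇ i j u v then 0 else wt W u v) , indicator (sameEdgeᵇ i j u v))
        ≡⟨ pair-if (sameEdgeᵇ i j u v) ⟩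
      (if sameEdgeᵇ i j u v then (0 , 1) else (wt W u v , 0)) ∎
      where
      open ≡-Reasoning
      pair-if : ∀ c → ((if c then 0 else wt W u v) , indicator c) ≡ (if c then (0 , 1) else (wt W u v , 0))
      pair-if true  = refl
      pair-if false = refl

    Adj-on-edge : (i <F j) ≡ true → Adj G i j ≡ true → ∀ u v → sameEdgeᵇ i j u v ≡ true → Adj G u v ≡ true
    Adj-on-edge i<j adj u v on-e =
      let lo≡i , hi≡j = ==F∧==F-sound (trans (lo-hi-==F i<j u v) on-e)
      in trans (sym (Adj-lo-hi G u v)) (trans (cong₂ (Adj G) lo≡i hi≡j) adj)

    weightedAt≡mapMon : (i <F j) ≡ true → Adj G i j ≡ true →
                        ∀ u v → weightedAt G T′ W i j u v ≡ mapMon zyWeight (tutteX G T′ u v)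
    weightedAt≡mapMon i<j adj u v
      with sameEdgeᵇ i j u v in on-e | zyWeight-xVar i<j u v
    ... | true  | zy rewrite Adj-on-edge i<j adj u v on-e = cong (λ mon → (mon , T′ u v) ∷ []) (sym zy)
    ... | false | zy with Adj G u v
    ...   | true  = cong (λ mon → (mon , T′ u v) ∷ []) (sym zy)
    ...   | false = refl

-- The monomials of Pf(T′_X)

insertAll-↭ : ∀ (x : A) xs {ys} → ys ∈ insertAll x xs → ys ↭ x ∷ xs
insertAll-↭ x []       (here refl) = ↭-refl
insertAll-↭ x (y ∷ xs) (here refl) = ↭-refl
insertAll-↭ x (y ∷ xs) (there ys∈) with ∈-map⁻ (y ∷_) ys∈
... | zs , zs∈ , refl = ↭-trans (↭-prep y (insertAll-↭ x xs zs∈)) (↭-swap y x ↭-refl)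

perms-↭ : ∀ (xs : List A) {σ} → σ ∈ perms xs → σ ↭ xs
perms-↭ []       (here refl) = ↭-refl
perms-↭ (x ∷ xs) σ∈ with ∈-concat⁻′ (map (insertAll x) (perms xs)) σ∈
... | ys , σ∈ys , ys∈ with ∈-map⁻ (insertAll x) ys∈
... | τ , τ∈ , refl = ↭-trans (insertAll-↭ x τ σ∈ys) (↭-prep x (perms-↭ xs τ∈))

data EvenLength {A : Set} : List A → Set where
  []    : EvenLength []
  pair : ∀ a b {r} → EvenLength r → EvenLength (a ∷ b ∷ r)

evenLength : ∀ k (xs : List A) → length xs ≡ k + k → EvenLength xs
evenLength k       []            _   = []
evenLength zero    (a ∷ [])      ()
evenLength (suc k) (a ∷ [])      len = contradiction (trans (ℕP.suc-injective len) (ℕP.+-suc k k)) λ ()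
evenLength zero    (a ∷ b ∷ r)   ()
evenLength (suc k) (a ∷ b ∷ r)   len =
  pair a b (evenLength k r (ℕP.suc-injective (trans (ℕP.suc-injective len) (ℕP.+-suc k k))))

partner : List (Fin n) → Fin n → Fin n
partner (a ∷ b ∷ r) u = if u ==F a then b else if u ==F b then a else partner r u
partner _           u = u

module _ (a b : Fin n) (r : List (Fin n)) where

  partner-fst : partner (a ∷ b ∷ r) a ≡ b
  partner-fst rewrite ==F-refl a = refl

  partner-snd : a ≢ b → partner (a ∷ b ∷ r) b ≡ a
  partner-snd a≢b rewrite ==F-≢ (a≢b ∘ sym) | ==F-refl b = refl

  partner-rest : ∀ {u} → u ≢ a → u ≢ b → partner (a ∷ b ∷ r) u ≡ partner r u
  partner-rest u≢a u≢b rewrite ==F-≢ u≢a | ==F-≢ u≢b = refl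

partner-∉ : ∀ (r : List (Fin n)) {u} → u ∉ r → partner r u ≡ u
partner-∉ []          u∉ = refl
partner-∉ (a ∷ [])    u∉ = refl
partner-∉ (a ∷ b ∷ r) u∉ =
  trans (partner-rest a b r (u∉ ∘ here) (u∉ ∘ there ∘ here)) (partner-∉ r (u∉ ∘ there ∘ there))

∈-drop₂ : ∀ {a b u : A} {r} → u ∈ a ∷ b ∷ r → u ≢ a → u ≢ b → u ∈ r
∈-drop₂ (here u≡a)         u≢a u≢b = contradiction u≡a u≢a
∈-drop₂ (there (here u≡b)) u≢a u≢b = contradiction u≡b u≢b
∈-drop₂ (there (there u∈)) u≢a u≢b = u∈

partner-∈ : ∀ (r : List (Fin n)) {u} → u ∈ r → partner r u ∈ r
partner-∈ (a ∷ [])    u∈ = u∈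
partner-∈ (a ∷ b ∷ r) {u} u∈ with u ≟F a
... | yes _   = there (here refl)
... | no u≢a with u ≟F b
...   | yes _   = here refl
...   | no u≢b  = there (there (partner-∈ r (∈-drop₂ u∈ u≢a u≢b)))

==F-lo-hi-fst : (a b y : Fin n) → a ≢ b → (a ==F lo a b ∧ y ==F hi a b) ≡ (a <F y ∧ b ==F y)
==F-lo-hi-fst a b y a≢b with a <F b in a<b | y ≟F b
... | true  | yes refl = trans (cong₂ _∧_ (==F-refl a) (==F-refl y)) (sym (cong₂ _∧_ a<b (==F-refl y)))
... | true  | no y≢b   = trans (cong₂ _∧_ (==F-refl a) (==F-≢ y≢b))
                                (sym (trans (cong (a <F y ∧_) (==F-≢ (y≢b ∘ sym))) (∧-zeroʳ _)))
... | false | yes refl = trans (cong (_∧ (y ==F a)) (==F-≢ a≢b)) (sym (cong (_∧ (y ==F y)) a<b))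
... | false | no y≢b   = trans (cong (_∧ (y ==F a)) (==F-≢ a≢b))
                                (sym (trans (cong (a <F y ∧_) (==F-≢ (y≢b ∘ sym))) (∧-zeroʳ _)))

edgeVar : Fin n × Fin n → MonX n
edgeVar (u , v) = xVar (lo u v) (hi u v)

edgeMonomial : List (Fin n × Fin n) → MonX n
edgeMonomial ps = foldr _·X_ εX (map edgeVar ps)

unpaired : ∀ (r : List (Fin n)) {x y} → x ∉ r → indicator (x <F y ∧ partner r x ==F y) ≡ 0
unpaired r {x} {y} x∉r = cong indicator (trans (cong (λ z → x <F y ∧ z ==F y) (partner-∉ r x∉r)) (<F∧==F-false x y))

exponent-edgeVar-partner : (a b : Fin n) (r : List (Fin n)) → a ≢ b → a ∉ r → b ∉ r → (x y : Fin n) →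
  indicator (x ==F lo a b ∧ y ==F hi a b) + indicator (x <F y ∧ partner r x ==F y) ≡
  indicator (x <F y ∧ partner (a ∷ b ∷ r) x ==F y)
exponent-edgeVar-partner a b r a≢b a∉r b∉r x y with x ≟F a
... | yes refl = trans (cong₂ _+_ (cong indicator (==F-lo-hi-fst x b y a≢b)) (unpaired r a∉r)) (ℕP.+-identityʳ _)
... | no x≢a with x ≟F b
...   | yes refl = trans (cong₂ _+_ (cong indicator swapped) (unpaired r b∉r)) (ℕP.+-identityʳ _)
  where
  swapped : (x ==F lo a x ∧ y ==F hi a x) ≡ (x <F y ∧ a ==F y)
  swapped = trans (cong₂ (λ l h → x ==F l ∧ y ==F h) (lo-comm a≢b) (hi-comm a≢b)) (==F-lo-hi-fst x a y x≢a)
...   | no x≢b   = cong (_+ _) (cong indicator (cong (_∧ (y ==F hi a b)) (lo-not-x (lo-∈ a b))))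
  where
  lo-not-x : lo a b ≡ a ⊎ lo a b ≡ b → (x ==F lo a b) ≡ false
  lo-not-x (inj₁ lo≡a) = trans (cong (x ==F_) lo≡a) (==F-≢ x≢a)
  lo-not-x (inj₂ lo≡b) = trans (cong (x ==F_) lo≡b) (==F-≢ x≢b)

exponent-edgeMonomial : ∀ (σ : List (Fin n)) → Unique σ → (x y : Fin n) →
                        exponent (edgeMonomial (pairsOf σ)) x y ≡ indicator (x <F y ∧ partner σ x ==F y)
exponent-edgeMonomial []          _ x y = trans (exponent-ε x y) (cong indicator (sym (<F∧==F-false x y)))
exponent-edgeMonomial (a ∷ [])    _ x y = trans (exponent-ε x y) (cong indicator (sym (<F∧==F-false x y)))
exponent-edgeMonomial (a ∷ b ∷ r) ((a≢b ∷ a∉r) ∷ b∉r ∷ uniq) x y = begin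
  exponent (edgeVar (a , b) ·X edgeMonomial (pairsOf r)) x y
    ≡⟨ exponent-· (edgeVar (a , b)) (edgeMonomial (pairsOf r)) x y ⟩
  exponent (edgeVar (a , b)) x y + exponent (edgeMonomial (pairsOf r)) x y
    ≡⟨ cong₂ _+_ (exponent-xVar (lo a b) (hi a b) x y) (exponent-edgeMonomial r uniq x y) ⟩
  indicator (x ==F lo a b ∧ y ==F hi a b) + indicator (x <F y ∧ partner r x ==F y)
    ≡⟨ exponent-edgeVar-partner a b r a≢b (All¬⇒¬Any a∉r) (All¬⇒¬Any b∉r) x y ⟩
  indicator (x <F y ∧ partner (a ∷ b ∷ r) x ==F y) ∎
  where open ≡-Reasoning

module _ (G : SimpleGraph n) where

  PairsAdjacent : List (Fin n) → Set
  PairsAdjacent σ = All (λ (u , v) → Adj G u v ≡ true) (pairsOf σ)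

  partner-mate : ∀ {σ} → Unique σ → EvenLength σ → PairsAdjacent σ → ∀ {u} → u ∈ σ →
                 partner σ u ≢ u × partner σ (partner σ u) ≡ u × Adj G u (partner σ u) ≡ true
  partner-mate ((a≢b ∷ a∉r) ∷ b∉r ∷ uniq) (pair a b {r} ev) (adj ∷ adjs) {u} u∈ with u ≟F a
  ... | yes refl = a≢b ∘ sym , partner-snd u b r a≢b , adj
  ... | no u≢a with u ≟F b
  ...   | yes refl = a≢b , partner-fst a u r , trans (Adj-sym G u a) adj
  ...   | no u≢b with partner-mate uniq ev adjs (∈-drop₂ u∈ u≢a u≢b)
  ...     | p≢u , pp≡u , adj-p = p≢u , trans (partner-rest a b r (≢-partner a∉r) (≢-partner b∉r)) pp≡u , adj-p
    where
    ≢-partner : ∀ {c} → All (c ≢_) r → partner r u ≢ c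
    ≢-partner c∉r p≡c = All.lookup c∉r (partner-∈ r (∈-drop₂ u∈ u≢a u≢b)) (sym p≡c)

module PfTerms (G : SimpleGraph n) (T′ : Fin n → Fin n → ℚ) where

  open PX n
  open PolyMembership (εX {n}) (_·X_ {n})

  ∈-prodP-tutteX : ∀ ps {t} → t ∈ prodP (map (uncurry (tutteX G T′)) ps) →
                   All (λ (u , v) → Adj G u v ≡ true) ps × proj₁ t ≡ edgeMonomial ps
  ∈-prodP-tutteX []             (here refl) = [] , refl
  ∈-prodP-tutteX ((u , v) ∷ ps) t∈ with Adj G u v in adj
  ... | true with ∈-⊗⁻ {p = (edgeVar (u , v) , T′ u v) ∷ []} t∈
  ...   | s , t′ , here refl , t′∈ , t≡ with ∈-prodP-tutteX ps t′∈
  ...     | adjs , t′≡ = adj ∷ adjs , trans t≡ (cong (edgeVar (u , v) ·X_) t′≡)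

  permutation-term-pmMonomial : ∀ k → n ≡ k + k → ∀ {σ t} → σ ∈ perms (allFin n) →
                                t ∈ prodP (map (uncurry (tutteX G T′)) (pairsOf σ)) →
                                ∃ λ m → T (isPMᵇ G m) × proj₁ t ≡ pmMonomial m
  permutation-term-pmMonomial k n≡k+k {σ} {t} σ∈ t∈ =
    tabulate (partner σ) , isPMᵇ-complete G (partner σ) isPM , trans t≡ (monomial-ext _ _ same-exponents)
    where
    adjs : PairsAdjacent G σ
    adjs = proj₁ (∈-prodP-tutteX (pairsOf σ) t∈)
    t≡ : proj₁ t ≡ edgeMonomial (pairsOf σ)
    t≡ = proj₂ (∈-prodP-tutteX (pairsOf σ) t∈)
    σ↭ : σ ↭ allFin n
    σ↭ = perms-↭ (allFin n) σ∈
    uniq : Unique σ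
    uniq = Unique-resp-↭ (setoid (Fin n)) (↭⇒↭ₛ (↭-sym σ↭)) (allFin⁺ n)
    even : EvenLength σ
    even = evenLength k σ (trans (↭-length σ↭) (trans (length-tabulate id) n≡k+k))
    mate : ∀ u → partner σ u ≢ u × partner σ (partner σ u) ≡ u × Adj G u (partner σ u) ≡ true
    mate u = partner-mate G uniq even adjs (∈-resp-↭ (↭-sym σ↭) (∈-allFin u))
    isPM : IsPerfectMatching G (partner σ)
    isPM = record { mate-≢ = proj₁ ∘ mate ; mate-mate = proj₁ ∘ proj₂ ∘ mate ; mate-adj = proj₂ ∘ proj₂ ∘ mate }
    same-exponents : ∀ x y → exponent (edgeMonomial (pairsOf σ)) x y ≡ exponent (pmMonomial (tabulate (partner σ))) x y
    same-exponents x y = trans (exponent-edgeMonomial σ uniq x y)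
      (sym (trans (exponent-pmMonomial (tabulate (partner σ)) x y)
                  (cong (λ z → indicator (x <F y ∧ z ==F y)) (lookup∘tabulate (partner σ) x))))

  Pf-term-pmMonomial : ∀ k → n ≡ k + k → ∀ {t} → t ∈ Pf n (tutteX G T′) →
                       ∃ λ m → T (isPMᵇ G m) × proj₁ t ≡ pmMonomial m
  Pf-term-pmMonomial k n≡k+k t∈ =
    let σ , t′ , σ∈ , t′∈ , t≡t′ = ∈-Pf⁻ t∈
        m , isPM , t′≡ = permutation-term-pmMonomial k n≡k+k σ∈ t′∈
    in m , isPM , trans t≡t′ t′≡

-- Coefficients as sums over perfect matchings

open ℚΣ using (∑; _when_)

when-∧ : ∀ (c : ℚ) a b → c when b when a ≡ c when (a ∧ b)
when-∧ c true  b = refl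
when-∧ c false b = refl

coeff-∑ : {M : Set} (_≟_ : DecidableEquality M) (p : Poly M) (mon : M) →
          coeff _≟_ p mon ≡ ∑ p (λ t → proj₂ t when does (proj₁ t ≟ mon))
coeff-∑ _≟_ p mon = ℚΣ.∑-filter (λ t → proj₁ t ≟ mon) p proj₂

coeff-mapMon : {M M′ : Set} (_≟_ : DecidableEquality M′) (φ : M → M′) (p : Poly M) (mon : M′) →
               coeff _≟_ (mapMon φ p) mon ≡ ∑ p (λ t → proj₂ t when does (φ (proj₁ t) ≟ mon))
coeff-mapMon _≟_ φ p mon = trans (coeff-∑ _≟_ (mapMon φ p) mon) (ℚΣ.∑-map p _ _)

does-≟₂ : (x y a b : ℕ) → does (×-≡-dec ℕP._≟_ ℕP._≟_ (x , y) (a , b)) ≡ (x ≡ᵇ a) ∧ (y ≡ᵇ b)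
does-≟₂ x y a b = does-⇔ (mk⇔ (λ eq → cong proj₁ eq , cong proj₂ eq) (λ (p , q) → cong₂ _,_ p q))
                         (×-≡-dec ℕP._≟_ ℕP._≟_ (x , y) (a , b)) ((x ℕP.≟ a) ×-dec (y ℕP.≟ b))

-- b = [e ∈ M] and (x , [b]) are the exponents of z and y for M in Pf(A_e), so W(M) = x + [b] W(e)
≡ᵇ-avoiding : ∀ b x a w → (x ≡ᵇ a) ∧ (indicator b ≡ᵇ 0) ≡ not b ∧ (x + indicator b * w ≡ᵇ a)
≡ᵇ-avoiding false x a w = trans (∧-identityʳ (x ≡ᵇ a)) (cong (_≡ᵇ a) (sym (ℕP.+-identityʳ x)))
≡ᵇ-avoiding true  x a w = ∧-zeroʳ (x ≡ᵇ a)

≡ᵇ-through : ∀ b x d w → (x ≡ᵇ d) ∧ (indicator b ≡ᵇ 1) ≡ b ∧ (x + indicator b * w ≡ᵇ d + w)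
≡ᵇ-through false x d w = ∧-zeroʳ (x ≡ᵇ d)
≡ᵇ-through true  x d w = trans (∧-identityʳ (x ≡ᵇ d)) (does-⇔ shifted (x ℕP.≟ d) (x + 1 * w ℕP.≟ d + w))
  where
  shifted : x ≡ d ⇔ x + 1 * w ≡ d + w
  shifted = mk⇔ (λ x≡d → cong₂ _+_ x≡d (ℕP.*-identityˡ w))
                (λ eq → ℕP.+-cancelʳ-≡ w x d (trans (cong (_+_ x) (sym (ℕP.*-identityˡ w))) eq))

≡ᵇ-through-below : ∀ b x a w → a < w → b ∧ (x + indicator b * w ≡ᵇ a) ≡ false
≡ᵇ-through-below false x a w a<w = refl
≡ᵇ-through-below true  x a w a<w = dec-false (x + 1 * w ℕP.≟ a) λ eq →
  ℕP.<⇒≱ a<w (ℕP.≤-trans (ℕP.m≤n+m w x) (ℕP.≤-reflexive (trans (cong (_+_ x) (sym (ℕP.*-identityˡ w))) eq)))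

module Coefficients (G : SimpleGraph n) (T′ : Fin n → Fin n → ℚ) (k : ℕ) (n≡k+k : n ≡ k + k) where

  open PfTerms G T′

  terms : Poly (MonX n)
  terms = PX.Pf n n (tutteX G T′)

  c[_] : (Vec (Fin n) n → Bool) → ℚ
  c[ P ] = ∑ (perfectMatchings G) (λ m → cM G T′ m when P m)

  c-cong : {P Q : Vec (Fin n) n → Bool} → (∀ m → P m ≡ Q m) → c[ P ] ≡ c[ Q ]
  c-cong P≗Q = ℚΣ.∑-cong (perfectMatchings G) λ {m} _ → cong (cM G T′ m when_) (P≗Q m)

  ∈-perfectMatchings⁻ : ∀ {m} → m ∈ perfectMatchings G → T (isPMᵇ G m)
  ∈-perfectMatchings⁻ m∈ = proj₂ (∈-filter⁻ _ {xs = allVecs n n} m∈)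

  ∑-perfectMatchings : (f : Vec (Fin n) n → ℚ) →
                       ∑ (perfectMatchings G) f ≡ ∑ (allVecs n n) (λ m → f m when isPMᵇ G m)
  ∑-perfectMatchings = ℚΣ.∑-filter-T (isPMᵇ G) _ (allVecs n n)

  ∑-perfectMatchings-point : ∀ {m₀} → T (isPMᵇ G m₀) → (f : Vec (Fin n) n → ℚ) →
                             (∀ m → T (isPMᵇ G m) → m ≢ m₀ → f m ≡ 0ℚ) →
                             ∑ (perfectMatchings G) f ≡ f m₀
  ∑-perfectMatchings-point {m₀} isPM₀ f f≗0 =
    trans (∑-perfectMatchings f)
          (trans (ℚΣ.∑-allVecs-point n _ m₀ off-m₀) (cong (f m₀ when_) (Equivalence.to T-≡ isPM₀)))
    where
    off-m₀ : ∀ m → m ≢ m₀ → f m when isPMᵇ G m ≡ 0ℚ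
    off-m₀ m m≢m₀ with isPMᵇ G m in isPM
    ... | true  = f≗0 m (Equivalence.from T-≡ isPM) m≢m₀
    ... | false = refl

  _≟X_ : DecidableEquality (MonX n)
  _≟X_ = Vec-≡-dec (Vec-≡-dec ℕP._≟_)

  Pf-expansion : (P : MonX n → Bool) → ∑ terms (λ t → proj₂ t when P (proj₁ t)) ≡ c[ P ∘ pmMonomial ]
  Pf-expansion P = sym (begin
    c[ P ∘ pmMonomial ]
      ≡⟨ ℚΣ.∑-cong (perfectMatchings G) (λ {m} _ → cong (_when P (pmMonomial m)) (coeff-∑ _≟X_ terms (pmMonomial m))) ⟩
    ∑ (perfectMatchings G) (λ m → ∑ terms (λ t → proj₂ t when does (proj₁ t ≟X pmMonomial m)) when P (pmMonomial m))
      ≡⟨ ℚΣ.∑-cong (perfectMatchings G) (λ {m} _ → ℚΣ.when-∑ (P (pmMonomial m)) terms _) ⟩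
    ∑ (perfectMatchings G) (λ m → ∑ terms (λ t → summand t m))
      ≡⟨ ℚΣ.∑-comm (perfectMatchings G) terms (λ m t → summand t m) ⟩
    ∑ terms (λ t → ∑ (perfectMatchings G) (summand t))
      ≡⟨ ℚΣ.∑-cong terms single-matching ⟩
    ∑ terms (λ t → proj₂ t when P (proj₁ t)) ∎)
    where
    open ≡-Reasoning
    summand : MonX n × ℚ → Vec (Fin n) n → ℚ
    summand t m = proj₂ t when does (proj₁ t ≟X pmMonomial m) when P (pmMonomial m)
    single-matching : ∀ {t} → t ∈ terms → ∑ (perfectMatchings G) (summand t) ≡ proj₂ t when P (proj₁ t)
    single-matching {t} t∈ =
      let m₀ , isPM₀ , t≡ = Pf-term-pmMonomial k n≡k+k t∈
          off-m₀ : ∀ m → T (isPMᵇ G m) → m ≢ m₀ → summand t m ≡ 0ℚ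
          off-m₀ m isPM m≢m₀ = trans (cong (λ b → proj₂ t when b when P (pmMonomial m))
                                           (dec-false (proj₁ t ≟X pmMonomial m) λ t≡′ →
                                              m≢m₀ (pmMonomial-injective (isPMᵇ-sound G m isPM) (isPMᵇ-sound G m₀ isPM₀)
                                                                         (trans (sym t≡′) t≡))))
                                     (ℚΣ.ε-when (P (pmMonomial m)))
      in trans (∑-perfectMatchings-point isPM₀ (summand t) off-m₀)
               (trans (cong (λ b → proj₂ t when b when P (pmMonomial m₀)) (dec-true (proj₁ t ≟X pmMonomial m₀) t≡))
                      (cong (λ mon → proj₂ t when P mon) (sym t≡)))

  _⊕₂_ : Mon₂ → Mon₂ → Mon₂
  (a , b) ⊕₂ (c , d) = (a + c , b + d)

  _≟₂_ : DecidableEquality Mon₂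
  _≟₂_ = ×-≡-dec ℕP._≟_ ℕP._≟_

  coeff-specialization : (φ : MonX n → Mon₂) → φ εX ≡ (0 , 0) → (∀ a b → φ (a ·X b) ≡ φ a ⊕₂ φ b) →
                         (B : Fin n → Fin n → Poly Mon₂) → (∀ u v → B u v ≡ mapMon φ (tutteX G T′ u v)) →
                         ∀ z → coeff₂ (P2.Pf n B) z ≡ c[ (λ m → does (φ (pmMonomial m) ≟₂ z)) ]
  coeff-specialization φ φ-ε φ-· B B≡φT z = begin
    coeff₂ (P2.Pf n B) z                                 ≡⟨ cong (λ p → coeff₂ p z) (Pf-mapMon n (tutteX G T′) B B≡φT) ⟩
    coeff₂ (mapMon φ terms) z                            ≡⟨ coeff-mapMon _≟₂_ φ terms z ⟩
    ∑ terms (λ t → proj₂ t when does (φ (proj₁ t) ≟₂ z)) ≡⟨ Pf-expansion (λ mon → does (φ mon ≟₂ z)) ⟩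
    c[ (λ m → does (φ (pmMonomial m) ≟₂ z)) ]            ∎
    where
    open ≡-Reasoning
    open PolyMap εX _·X_ (0 , 0) _⊕₂_ φ φ-ε φ-·

  module _ (W : Fin n → Fin n → ℕ) where

    open Weighting G T′ W

    cAt : ℕ → ℚ
    cAt w = c[ (λ m → weightPM W m ≡ᵇ w) ]

    cAvoiding cThrough : Fin n → Fin n → ℕ → ℚ
    cAvoiding i j w = c[ (λ m → not (inPM m i j) ∧ (weightPM W m ≡ᵇ w)) ]
    cThrough  i j w = c[ (λ m → inPM m i j ∧ (weightPM W m ≡ᵇ w)) ]

    coeff-PfA : ∀ a → coeff₂ (P2.Pf n (weighted G T′ W)) (a , 0) ≡ cAt a
    coeff-PfA a =
      trans (coeff-specialization zWeight (cong (_, 0) (weight-ε W)) (λ x y → cong (_, 0) (weight-· W x y))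
                                  (weighted G T′ W) weighted≡mapMon (a , 0))
            (c-cong λ m → trans (does-≟₂ (weight W (pmMonomial m)) 0 a 0)
                                (trans (∧-identityʳ _) (cong (_≡ᵇ a) (weight-pmMonomial W m))))

    cBar≡cAvoiding : ∀ i j w → cBar G T′ W i j w ≡ cAvoiding i j w
    cBar≡cAvoiding i j w = filtered _
      where
      filtered : (avoids? : ∀ m → Dec (T (not (inPM m i j)))) →
                 ∑ (filter (λ m → weightPM W m ℕP.≟ w) (filter avoids? (perfectMatchings G))) (cM G T′) ≡ cAvoiding i j w
      filtered avoids? =
        trans (ℚΣ.∑-filter (λ m → weightPM W m ℕP.≟ w) (filter avoids? (perfectMatchings G)) (cM G T′))
              (trans (ℚΣ.∑-filter-T (λ m → not (inPM m i j)) avoids? (perfectMatchings G) _)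
                     (ℚΣ.∑-cong (perfectMatchings G) λ {m} _ → when-∧ (cM G T′ m) (not (inPM m i j)) (weightPM W m ≡ᵇ w)))

    cAt-split : ∀ i j w → cAt w ≡ cAvoiding i j w +ℚ cThrough i j w
    cAt-split i j w = trans (ℚΣ.∑-cong (perfectMatchings G) λ {m} _ → split (cM G T′ m) (inPM m i j) (weightPM W m ≡ᵇ w))
                            (ℚΣ.∑-∙ (perfectMatchings G) _ _)
      where
      split : ∀ c b p → c when p ≡ c when (not b ∧ p) +ℚ c when (b ∧ p)
      split c false p = sym (ℚP.+-identityʳ (c when p))
      split c true  p = sym (ℚP.+-identityˡ (c when p))

    module _ {i j : Fin n} (i<j : (i <F j) ≡ true) where

      exponent-pmMonomial-edge : ∀ m → exponent (pmMonomial m) i j ≡ indicator (inPM m i j)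
      exponent-pmMonomial-edge m = trans (exponent-pmMonomial m i j) (cong (λ b → indicator (b ∧ inPM m i j)) i<j)

      weightPM-split : ∀ m → weightPM W m ≡ weight (clearWeight W i j) (pmMonomial m) + indicator (inPM m i j) * W i j
      weightPM-split m = begin
        weightPM W m                                                   ≡⟨ sym (weight-pmMonomial W m) ⟩
        weight W (pmMonomial m)                                        ≡⟨ weight-clearWeight W i j (pmMonomial m) ⟩
        weight (clearWeight W i j) (pmMonomial m) + exponent (pmMonomial m) i j * W i j
          ≡⟨ cong (λ e → weight (clearWeight W i j) (pmMonomial m) + e * W i j) (exponent-pmMonomial-edge m) ⟩
        weight (clearWeight W i j) (pmMonomial m) + indicator (inPM m i j) * W i j ∎
        where open ≡-Reasoning

      cThrough-below : ∀ w → w < W i j → cThrough i j w ≡ 0ℚ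
      cThrough-below w w<Wij = trans (c-cong none) (ℚΣ.∑-zero (perfectMatchings G) λ _ → refl)
        where
        none : ∀ m → inPM m i j ∧ (weightPM W m ≡ᵇ w) ≡ false
        none m = trans (cong (λ x → inPM m i j ∧ (x ≡ᵇ w)) (weightPM-split m))
                       (≡ᵇ-through-below (inPM m i j) (weight (clearWeight W i j) (pmMonomial m)) w (W i j) w<Wij)

      module _ (adj : Adj G i j ≡ true) where

        private
          coeff-PfAₑ : ∀ z → coeff₂ (P2.Pf n (weightedAt G T′ W i j)) z ≡
                             c[ (λ m → does (zyWeight i j (pmMonomial m) ≟₂ z)) ]
          coeff-PfAₑ = coeff-specialization (zyWeight i j) (cong₂ _,_ (weight-ε (clearWeight W i j)) (exponent-ε i j))
                         (λ x y → cong₂ _,_ (weight-· (clearWeight W i j) x y) (exponent-· x y i j))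
                         (weightedAt G T′ W i j) (weightedAt≡mapMon i j i<j adj)

        P₀≡cAvoiding : ∀ a → P₀ G T′ W i j a ≡ cAvoiding i j a
        P₀≡cAvoiding a = trans (coeff-PfAₑ (a , 0)) (c-cong λ m →
          let x = weight (clearWeight W i j) (pmMonomial m); b = inPM m i j in begin
          does (zyWeight i j (pmMonomial m) ≟₂ (a , 0)) ≡⟨ does-≟₂ x _ a 0 ⟩
          (x ≡ᵇ a) ∧ (exponent (pmMonomial m) i j ≡ᵇ 0) ≡⟨ cong (λ e → (x ≡ᵇ a) ∧ (e ≡ᵇ 0)) (exponent-pmMonomial-edge m) ⟩
          (x ≡ᵇ a) ∧ (indicator b ≡ᵇ 0)                 ≡⟨ ≡ᵇ-avoiding b x a (W i j) ⟩
          not b ∧ (x + indicator b * W i j ≡ᵇ a)        ≡⟨ cong (λ w → not b ∧ (w ≡ᵇ a)) (sym (weightPM-split m)) ⟩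
          not b ∧ (weightPM W m ≡ᵇ a)                   ∎)
          where open ≡-Reasoning

        P₁≡cThrough : ∀ d → P₁ G T′ W i j d ≡ cThrough i j (d + W i j)
        P₁≡cThrough d = trans (coeff-PfAₑ (d , 1)) (c-cong λ m →
          let x = weight (clearWeight W i j) (pmMonomial m); b = inPM m i j in begin
          does (zyWeight i j (pmMonomial m) ≟₂ (d , 1)) ≡⟨ does-≟₂ x _ d 1 ⟩
          (x ≡ᵇ d) ∧ (exponent (pmMonomial m) i j ≡ᵇ 1) ≡⟨ cong (λ e → (x ≡ᵇ d) ∧ (e ≡ᵇ 1)) (exponent-pmMonomial-edge m) ⟩
          (x ≡ᵇ d) ∧ (indicator b ≡ᵇ 1)                 ≡⟨ ≡ᵇ-through b x d (W i j) ⟩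
          b ∧ (x + indicator b * W i j ≡ᵇ d + W i j)    ≡⟨ cong (λ w → b ∧ (w ≡ᵇ d + W i j)) (sym (weightPM-split m)) ⟩
          b ∧ (weightPM W m ≡ᵇ d + W i j)               ∎)
          where open ≡-Reasoning

    cAt-at-vertex : ∀ u w → cAt w ≡ ∑ (allFin n) (λ v → cThrough (lo u v) (hi u v) w when Adj G u v)
    cAt-at-vertex u w = sym (begin
      ∑ (allFin n) (λ v → cThrough (lo u v) (hi u v) w when Adj G u v)
        ≡⟨ ℚΣ.∑-cong (allFin n) (λ {v} _ → ℚΣ.when-∑ (Adj G u v) (perfectMatchings G) _) ⟩
      ∑ (allFin n) (λ v → ∑ (perfectMatchings G) (λ m → summand m v))
        ≡⟨ ℚΣ.∑-comm (allFin n) (perfectMatchings G) (λ v m → summand m v) ⟩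
      ∑ (perfectMatchings G) (λ m → ∑ (allFin n) (summand m))
        ≡⟨ ℚΣ.∑-cong (perfectMatchings G) single-mate ⟩
      cAt w ∎)
      where
      open ≡-Reasoning
      summand : Vec (Fin n) n → Fin n → ℚ
      summand m v = cM G T′ m when (inPM m (lo u v) (hi u v) ∧ (weightPM W m ≡ᵇ w)) when Adj G u v
      single-mate : ∀ {m} → m ∈ perfectMatchings G → ∑ (allFin n) (summand m) ≡ cM G T′ m when (weightPM W m ≡ᵇ w)
      single-mate {m} m∈ = trans (ℚΣ.∑-allFin-point n (summand m) (lookup m u) off-mate) at-mate
        where
        isPM : IsPerfectMatching G (lookup m)
        isPM = isPMᵇ-sound G m (∈-perfectMatchings⁻ m∈)
        off-mate : ∀ v → v ≢ lookup m u → summand m v ≡ 0ℚ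
        off-mate v v≢mu =
          trans (cong (λ b → cM G T′ m when (b ∧ (weightPM W m ≡ᵇ w)) when Adj G u v)
                      (trans (inPM-lo-hi m isPM u v) (==F-≢ (v≢mu ∘ sym))))
                (ℚΣ.ε-when (Adj G u v))
        at-mate : summand m (lookup m u) ≡ cM G T′ m when (weightPM W m ≡ᵇ w)
        at-mate = cong₂ (λ b a → cM G T′ m when (b ∧ (weightPM W m ≡ᵇ w)) when a)
                        (trans (inPM-lo-hi m isPM u (lookup m u)) (==F-refl (lookup m u)))
                        (IsPerfectMatching.mate-adj isPM u)

-- Lowest degrees, and sums of terms equal to 0 or c

leastDeg-≤ : (p : ℕ → ℚ) (a : ℕ) → p a ≢ 0ℚ → ∃ λ w → LeastDeg p w × w ≤ a
leastDeg-≤ p = <-rec _ least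
  where
  least : ∀ a → (∀ {b} → b < a → p b ≢ 0ℚ → ∃ λ w → LeastDeg p w × w ≤ b) →
          p a ≢ 0ℚ → ∃ λ w → LeastDeg p w × w ≤ a
  least a below pa≢0 with ℕP.anyUpTo? (λ b → ¬? (p b ℚP.≟ 0ℚ)) a
  ... | yes (b , b<a , pb≢0) = let w , lw , w≤b = below b<a pb≢0 in w , lw , ℕP.≤-trans w≤b (ℕP.<⇒≤ b<a)
  ... | no none = a , (pa≢0 , λ b b<a → decidable-stable (p b ℚP.≟ 0ℚ) λ pb≢0 → none (b , b<a , pb≢0)) , ℕP.≤-refl

-- Read c = p₀ + z^s p₁, with q standing for z^s p₁.
leastDeg-shift : (c p₀ q p₁ : ℕ → ℚ) (s w₀ : ℕ) →
                 (∀ a → c a ≡ p₀ a +ℚ q a) → (∀ d → p₁ d ≡ q (d + s)) → (∀ a → a < s → q a ≡ 0ℚ) →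
                 LeastDeg c w₀ → p₀ w₀ ≢ 0ℚ → q w₀ ≢ 0ℚ →
                 Σ ℕ λ w̄ → Σ ℕ λ wₑ → LeastDeg p₀ w̄ × LeastDeg p₁ wₑ × w̄ ≡ wₑ + s
leastDeg-shift c p₀ q p₁ s w₀ c≡p₀+q p₁≡q q-low (_ , c-below) p₀≢0 q≢0 =
  w̄ , wₑ , ld₀ , ld₁ , compare (ℕP.<-cmp w̄ (wₑ + s))
  where
  open ≡-Reasoning
  s≤w₀ : s ≤ w₀
  s≤w₀ = ℕP.≮⇒≥ λ w₀<s → q≢0 (q-low w₀ w₀<s)
  p₁≢0 : p₁ (w₀ ∸ s) ≢ 0ℚ
  p₁≢0 p₁≡0 = q≢0 (trans (cong q (sym (ℕP.m∸n+n≡m s≤w₀))) (trans (sym (p₁≡q (w₀ ∸ s))) p₁≡0))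
  L₀ : ∃ λ w → LeastDeg p₀ w × w ≤ w₀
  L₀ = leastDeg-≤ p₀ w₀ p₀≢0
  L₁ : ∃ λ w → LeastDeg p₁ w × w ≤ w₀ ∸ s
  L₁ = leastDeg-≤ p₁ (w₀ ∸ s) p₁≢0
  w̄ wₑ : ℕ
  w̄ = proj₁ L₀
  wₑ = proj₁ L₁
  ld₀ : LeastDeg p₀ w̄
  ld₀ = proj₁ (proj₂ L₀)
  ld₁ : LeastDeg p₁ wₑ
  ld₁ = proj₁ (proj₂ L₁)
  wₑ+s≤w₀ : wₑ + s ≤ w₀
  wₑ+s≤w₀ = subst (wₑ + s ≤_) (ℕP.m∸n+n≡m s≤w₀) (ℕP.+-monoˡ-≤ s (proj₂ (proj₂ L₁)))
  sum-below : ∀ a → a < w₀ → p₀ a +ℚ q a ≡ 0ℚ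
  sum-below a a<w₀ = trans (sym (c≡p₀+q a)) (c-below a a<w₀)
  q-below : ∀ a → a < wₑ + s → q a ≡ 0ℚ
  q-below a a<wₑ+s with a ℕP.<? s
  ... | yes a<s = q-low a a<s
  ... | no a≮s  = trans (cong q (sym a∸s+s≡a)) (trans (sym (p₁≡q (a ∸ s))) (proj₂ ld₁ (a ∸ s) a∸s<wₑ))
    where
    a∸s+s≡a : a ∸ s + s ≡ a
    a∸s+s≡a = ℕP.m∸n+n≡m (ℕP.≮⇒≥ a≮s)
    a∸s<wₑ : a ∸ s < wₑ
    a∸s<wₑ = ℕP.+-cancelʳ-< s (a ∸ s) wₑ (subst (_< wₑ + s) (sym a∸s+s≡a) a<wₑ+s)
  compare : Tri (w̄ < wₑ + s) (w̄ ≡ wₑ + s) (wₑ + s < w̄) → w̄ ≡ wₑ + s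
  compare (tri≈ _ w̄≡ _) = w̄≡
  compare (tri< w̄< _ _) = contradiction (begin
    p₀ w̄          ≡⟨ sym (ℚP.+-identityʳ (p₀ w̄)) ⟩
    p₀ w̄ +ℚ 0ℚ    ≡⟨ cong (p₀ w̄ +ℚ_) (sym (q-below w̄ w̄<)) ⟩
    p₀ w̄ +ℚ q w̄   ≡⟨ sum-below w̄ (ℕP.<-≤-trans w̄< wₑ+s≤w₀) ⟩
    0ℚ            ∎) (proj₁ ld₀)
  compare (tri> _ _ <w̄) = contradiction (begin
    p₁ wₑ                       ≡⟨ p₁≡q wₑ ⟩
    q (wₑ + s)                  ≡⟨ sym (ℚP.+-identityˡ (q (wₑ + s))) ⟩
    0ℚ +ℚ q (wₑ + s)            ≡⟨ cong (_+ℚ q (wₑ + s)) (sym (proj₂ ld₀ (wₑ + s) <w̄)) ⟩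
    p₀ (wₑ + s) +ℚ q (wₑ + s)   ≡⟨ sum-below (wₑ + s) (ℕP.<-≤-trans <w̄ (proj₂ (proj₂ L₀))) ⟩
    0ℚ                          ∎) (proj₁ ld₁)

module _ {c : ℚ} (c≢0 : c ≢ 0ℚ) where

  ×ℚ-≢0 : ∀ k → suc k ×ℚ c ≢ 0ℚ
  ×ℚ-≢0 k with ℚP.<-cmp c 0ℚ
  ... | tri< c<0 _ _ = ℚP.<⇒≢ (negative k c<0)
    where
    negative : ∀ k → c <ℚ 0ℚ → suc k ×ℚ c <ℚ 0ℚ
    negative zero    c<0 = subst (_<ℚ 0ℚ) (sym (ℚP.+-identityʳ c)) c<0
    negative (suc k) c<0 = subst (c +ℚ suc k ×ℚ c <ℚ_) (ℚP.+-identityʳ 0ℚ) (ℚP.+-mono-< c<0 (negative k c<0))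
  ... | tri≈ _ c≡0 _ = contradiction c≡0 c≢0
  ... | tri> _ _ 0<c = ℚP.<⇒≢ (positive k 0<c) ∘ sym
    where
    positive : ∀ k → 0ℚ <ℚ c → 0ℚ <ℚ suc k ×ℚ c
    positive zero    0<c = subst (0ℚ <ℚ_) (sym (ℚP.+-identityʳ c)) 0<c
    positive (suc k) 0<c = subst (_<ℚ c +ℚ suc k ×ℚ c) (ℚP.+-identityʳ 0ℚ) (ℚP.+-mono-< 0<c (positive k 0<c))

  ×ℚ-≡-once : ∀ k → k ×ℚ c ≡ c → k ≡ 1
  ×ℚ-≡-once zero          0≡c = contradiction (sym 0≡c) c≢0
  ×ℚ-≡-once (suc zero)    _   = refl
  ×ℚ-≡-once (suc (suc k)) k×c≡c = contradiction (identityʳ-unique c (suc k ×ℚ c) k×c≡c) (×ℚ-≢0 k)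

  module _ (g : A → ℚ) where

    nonzero? : ∀ x → Dec (g x ≢ 0ℚ)
    nonzero? x = ¬? (g x ℚP.≟ 0ℚ)

    ∑-zero-or-c : ∀ xs → (∀ {x} → x ∈ xs → g x ≡ 0ℚ ⊎ g x ≡ c) → ∑ xs g ≡ length (filter nonzero? xs) ×ℚ c
    ∑-zero-or-c []       _        = refl
    ∑-zero-or-c (x ∷ xs) zero-or-c = step (g x ℚP.≟ 0ℚ) (zero-or-c (here refl))
      where
      ih : ∑ xs g ≡ length (filter nonzero? xs) ×ℚ c
      ih = ∑-zero-or-c xs (zero-or-c ∘ there)
      step : Dec (g x ≡ 0ℚ) → g x ≡ 0ℚ ⊎ g x ≡ c → ∑ (x ∷ xs) g ≡ length (filter nonzero? (x ∷ xs)) ×ℚ c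
      step (yes gx≡0) _         = trans (cong₂ _+ℚ_ gx≡0 ih) (trans (ℚP.+-identityˡ _)
                                    (cong (λ ys → length ys ×ℚ c) (sym (filter-reject nonzero? (λ gx≢0 → gx≢0 gx≡0)))))
      step (no gx≢0)  (inj₁ gx≡0) = contradiction gx≡0 gx≢0
      step (no gx≢0)  (inj₂ gx≡c) = trans (cong₂ _+ℚ_ gx≡c ih)
                                          (cong (λ ys → length ys ×ℚ c) (sym (filter-accept nonzero? gx≢0)))

    unique-nonzero-summand : ∀ xs → (∀ {x} → x ∈ xs → g x ≡ 0ℚ ⊎ g x ≡ c) → ∑ xs g ≡ c →
                             ∃ λ x → x ∈ xs × g x ≢ 0ℚ × (∀ {y} → y ∈ xs → g y ≢ 0ℚ → y ≡ x)
    unique-nonzero-summand xs zero-or-c ∑≡c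
      with filter nonzero? xs in filtered
         | ×ℚ-≡-once (length (filter nonzero? xs)) (trans (sym (∑-zero-or-c xs zero-or-c)) ∑≡c)
    ... | []         | ()
    ... | _ ∷ _ ∷ _  | ()
    ... | x ∷ []     | _ =
      x , proj₁ x∈ , proj₂ x∈ , λ y∈ gy≢0 → only-x (subst (_ ∈_) filtered (∈-filter⁺ nonzero? y∈ gy≢0))
      where
      x∈ : x ∈ xs × g x ≢ 0ℚ
      x∈ = ∈-filter⁻ nonzero? (subst (x ∈_) (sym filtered) (here refl))
      only-x : ∀ {y} → y ∈ x ∷ [] → y ≡ x
      only-x (here y≡x) = y≡x

-- The two alternatives

[+m+n]-[+m]≡+n : ∀ m n → + (m + n) - + m ≡ + n
[+m+n]-[+m]≡+n m n =
  trans (ℤP.[+m]-[+n]≡m⊖n (m + n) m) (trans (ℤP.⊖-≥ (ℕP.m≤m+n m n)) (cong +_ (ℕP.m+n∸m≡n m n)))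

module Dichotomy (G : SimpleGraph n) (T′ : Fin n → Fin n → ℚ) (k : ℕ) (n≡k+k : n ≡ k + k)
                 (W : Fin n → Fin n → ℕ) (w₀ : ℕ)
                 (leastPfA : LeastDeg (λ a → coeff₂ (P2.Pf n (weighted G T′ W)) (a , 0)) w₀) where

  open Coefficients G T′ k n≡k+k

  leastAt : LeastDeg (cAt W) w₀
  leastAt = (λ cAt≡0 → proj₁ leastPfA (trans (coeff-PfA W w₀) cAt≡0))
          , (λ a a<w₀ → trans (sym (coeff-PfA W a)) (proj₂ leastPfA a a<w₀))

  BothNonzero : Fin n → Fin n → Set
  BothNonzero i j = T (i <F j) × Adj G i j ≡ true × cThrough W i j w₀ ≢ 0ℚ × cAvoiding W i j w₀ ≢ 0ℚ

  bothNonzero? : ∀ i j → Dec (BothNonzero i j)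
  bothNonzero? i j = T? (i <F j) ×-dec (Adj G i j BoolP.≟ true)
                     ×-dec ¬? (cThrough W i j w₀ ℚP.≟ 0ℚ) ×-dec ¬? (cAvoiding W i j w₀ ℚP.≟ 0ℚ)

  both-nonzero⇒shift : ∀ {i j} → BothNonzero i j →
    NonZeroPoly (P₀ G T′ W i j) × NonZeroPoly (P₁ G T′ W i j) ×
    (Σ ℕ λ w̄ₑ → Σ ℕ λ wₑ →
       LeastDeg (P₀ G T′ W i j) w̄ₑ × LeastDeg (P₁ G T′ W i j) wₑ × + W i j ≡ + w̄ₑ - + wₑ)
  both-nonzero⇒shift {i} {j} (i<j , adj , through≢0 , avoiding≢0) =
    let w̄ₑ , wₑ , ld₀ , ld₁ , w̄ₑ≡ = leastDeg-shift (cAt W) (P₀ G T′ W i j) (cThrough W i j) (P₁ G T′ W i j) (W i j) w₀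
                                      split (P₁≡cThrough W i<j′ adj) (cThrough-below W i<j′) leastAt
                                      (avoiding≢0 ∘ trans (sym (P₀≡cAvoiding W i<j′ adj w₀))) through≢0
    in (w̄ₑ , proj₁ ld₀) , (wₑ , proj₁ ld₁) , w̄ₑ , wₑ , ld₀ , ld₁ ,
       trans (sym ([+m+n]-[+m]≡+n wₑ (W i j))) (cong (λ w → + w - + wₑ) (sym w̄ₑ≡))
    where
    i<j′ : (i <F j) ≡ true
    i<j′ = Equivalence.to T-≡ i<j
    split : ∀ a → cAt W a ≡ P₀ G T′ W i j a +ℚ cThrough W i j a
    split a = trans (cAt-split W i j a) (cong (_+ℚ cThrough W i j a) (sym (P₀≡cAvoiding W i<j′ adj a)))

  cBar≡0⇔P₀≡0 : ∀ i j → T (i <F j) → Adj G i j ≡ true →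
                cBar G T′ W i j w₀ ≡ 0ℚ ⇔ P₀ G T′ W i j w₀ ≡ 0ℚ
  cBar≡0⇔P₀≡0 i j i<j adj = mk⇔ (trans (sym same)) (trans same)
    where
    same : cBar G T′ W i j w₀ ≡ P₀ G T′ W i j w₀
    same = trans (cBar≡cAvoiding W i j w₀) (sym (P₀≡cAvoiding W (Equivalence.to T-≡ i<j) adj w₀))

  module _ (none : ∀ i j → ¬ BothNonzero i j) {u v : Fin n} (adj : Adj G u v ≡ true) where

    private
      i<j : (lo u v <F hi u v) ≡ true
      i<j = lo<hi λ u≡v → contradiction (trans (sym adj) (trans (cong (Adj G u) (sym u≡v)) (Adj-irrefl G u))) λ ()
      adj′ : Adj G (lo u v) (hi u v) ≡ true
      adj′ = trans (Adj-lo-hi G u v) adj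
      through≢0⇒avoiding≡0 : cThrough W (lo u v) (hi u v) w₀ ≢ 0ℚ → cAvoiding W (lo u v) (hi u v) w₀ ≡ 0ℚ
      through≢0⇒avoiding≡0 through≢0 = decidable-stable (cAvoiding W (lo u v) (hi u v) w₀ ℚP.≟ 0ℚ)
        λ avoiding≢0 → none (lo u v) (hi u v) (Equivalence.from T-≡ i<j , adj′ , through≢0 , avoiding≢0)
      avoiding≡0⇒through≡cAt : cAvoiding W (lo u v) (hi u v) w₀ ≡ 0ℚ → cThrough W (lo u v) (hi u v) w₀ ≡ cAt W w₀
      avoiding≡0⇒through≡cAt avoiding≡0 = sym (trans (cAt-split W (lo u v) (hi u v) w₀)
        (trans (cong (_+ℚ cThrough W (lo u v) (hi u v) w₀) avoiding≡0) (ℚP.+-identityˡ _)))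

    through-zero-or-cAt : cThrough W (lo u v) (hi u v) w₀ ≡ 0ℚ ⊎ cThrough W (lo u v) (hi u v) w₀ ≡ cAt W w₀
    through-zero-or-cAt with cThrough W (lo u v) (hi u v) w₀ ℚP.≟ 0ℚ
    ... | yes through≡0 = inj₁ through≡0
    ... | no through≢0  = inj₂ (avoiding≡0⇒through≡cAt (through≢0⇒avoiding≡0 through≢0))

    through≢0⇔cBar≡0 : cThrough W (lo u v) (hi u v) w₀ ≢ 0ℚ ⇔ cBar G T′ W (lo u v) (hi u v) w₀ ≡ 0ℚ
    through≢0⇔cBar≡0 = mk⇔
      (λ through≢0 → trans (cBar≡cAvoiding W (lo u v) (hi u v) w₀) (through≢0⇒avoiding≡0 through≢0))
      (λ cBar≡0 → proj₁ leastAt ∘ trans (sym (avoiding≡0⇒through≡cAt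
                    (trans (sym (cBar≡cAvoiding W (lo u v) (hi u v) w₀)) cBar≡0))))

  matching : (∀ i j → ¬ BothNonzero i j) → ∀ u → Σ (Fin n) λ v →
             Adj G u v ≡ true × cBar G T′ W (lo u v) (hi u v) w₀ ≡ 0ℚ ×
             (∀ v′ → Adj G u v′ ≡ true → cBar G T′ W (lo u v′) (hi u v′) w₀ ≡ 0ℚ → v′ ≡ v)
  matching none u =
    let v , _ , gv≢0 , only-v = unique-nonzero-summand (proj₁ leastAt) g (allFin n) zero-or-cAt (sym (cAt-at-vertex W u w₀))
        adj = adjacent gv≢0
    in v , adj , Equivalence.to (through≢0⇔cBar≡0 none adj) (gv≢0 ∘ trans (g-adjacent adj)) ,
       λ v′ adj′ cBar≡0 → only-v (∈-allFin v′)
                            (Equivalence.from (through≢0⇔cBar≡0 none adj′) cBar≡0 ∘ trans (sym (g-adjacent adj′)))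
    where
    g : Fin n → ℚ
    g v = cThrough W (lo u v) (hi u v) w₀ when Adj G u v
    g-adjacent : ∀ {v} → Adj G u v ≡ true → g v ≡ cThrough W (lo u v) (hi u v) w₀
    g-adjacent adj = cong (cThrough W _ _ w₀ when_) adj
    adjacent : ∀ {v} → g v ≢ 0ℚ → Adj G u v ≡ true
    adjacent {v} gv≢0 with Adj G u v
    ... | true  = refl
    ... | false = contradiction refl gv≢0
    zero-or-cAt : ∀ {v} → v ∈ allFin n → g v ≡ 0ℚ ⊎ g v ≡ cAt W w₀
    zero-or-cAt {v} _ with Adj G u v in adj
    ... | true  = through-zero-or-cAt none adj
    ... | false = inj₁ refl

lemma4p1 : ∀ {n : ℕ} (G : SimpleGraph n) → HasPerfectMatching G →
  (x : Fin n → Fin n → ℚ) → FullRank (tutteEval G x) →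
  (W : Fin n → Fin n → ℕ) → (w₀ : ℕ) →
  LeastDeg (λ a → coeff₂ (P2.Pf n (weighted G (tutteEval G x) W)) (a , 0)) w₀ →
  (Σ (Fin n) λ i → Σ (Fin n) λ j →
     T (i <F j) × Adj G i j ≡ true ×
     NonZeroPoly (P₀ G (tutteEval G x) W i j) ×
     NonZeroPoly (P₁ G (tutteEval G x) W i j) ×
     (Σ ℕ λ w̄ₑ → Σ ℕ λ wₑ →
        LeastDeg (P₀ G (tutteEval G x) W i j) w̄ₑ ×
        LeastDeg (P₁ G (tutteEval G x) W i j) wₑ ×
        + W i j ≡ + w̄ₑ - + wₑ))
  ⊎
  ((∀ u → Σ (Fin n) λ v →
      Adj G u v ≡ true × cBar G (tutteEval G x) W (lo u v) (hi u v) w₀ ≡ 0ℚ ×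
      (∀ v′ → Adj G u v′ ≡ true →
         cBar G (tutteEval G x) W (lo u v′) (hi u v′) w₀ ≡ 0ℚ → v′ ≡ v))
   ×
   (∀ i j → T (i <F j) → Adj G i j ≡ true →
      (cBar G (tutteEval G x) W i j w₀ ≡ 0ℚ) ⇔ (P₀ G (tutteEval G x) W i j w₀ ≡ 0ℚ)))
lemma4p1 {n} G (m₀ , isPM₀) x _ W w₀ leastPfA =
  Sum.map (λ (i , j , both) → i , j , proj₁ both , proj₁ (proj₂ both) , both-nonzero⇒shift both)
          (λ none → matching (λ i j both → none (i , j , both)) , cBar≡0⇔P₀≡0)
          (toSum (any? λ i → any? λ j → bothNonzero? i j))
  where
  open IsPerfectMatching (isPMᵇ-sound G m₀ isPM₀)
  evenness : ∃ λ k → n ≡ k + k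
  evenness = involution-even (lookup m₀) mate-mate mate-≢
  open Dichotomy G (tutteEval G x) (proj₁ evenness) (proj₂ evenness) W w₀ leastPfA
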